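{- Let \[ c := \sum_{p} \frac{1}{p(p+1)} \prod_{p' < p} \left(1 - \frac{1}{p'}\right) \approx 0.2296, \] where $p$ runs over all primes and the product runs over all primes $p'<p$. Then, as $n \to \infty$, \[ s(n) = c\cdot n + O\!\left(\frac{n}{\log n \, \log\log n}\right). \] In particular, $\lim_{n\to\infty} s(n)/n = c$.
   Context: For a positive integer $n$, $n \bmod k$ denotes the least nonnegative remainder of $n$ upon division by $k$. Let $S(n) := \{ n \bmod k : k \in \{1,2,\ldots,\lfloor n/2\rfloor\}\}$ and $s(n) := |S(n)|$, i.e. $s(n)$ is the number of distinct values of $n \bmod k$ for $1 \le k \le \lfloor n/2 \rfloor$. -}

module Defs where

open import Data.Nat using (ℕ; zero; suc; _<?_)
open import Data.Nat.DivMod using (_/_; _%_)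
open import Data.Nat.Primality using (prime?)
open import Data.Nat.Logarithm using (⌊log₂_⌋)
open import Data.List using (List; []; _∷_; map; upTo; filter; length; deduplicate)
open import Data.Integer using (+_)
open import Data.Rational as ℚ using (ℚ; 0ℚ; 1ℚ)

-- S(n) = { n mod k : 1 ≤ k ≤ ⌊n/2⌋ } as a list (k = suc i, i < ⌊n/2⌋);
-- s(n) = number of distinct elements.
remainders : ℕ → List ℕ
remainders n = map (λ i → n % suc i) (upTo (n / 2))

s : ℕ → ℕ
s n = length (deduplicate Data.Nat._≟_ (remainders n))

-- the rational 1/m (only used for primes m ≥ 2; 1/0 := 0 is irrelevant)
inv : ℕ → ℚ
inv zero = 0ℚ
inv (suc k) = (+ 1) ℚ./ suc k

primesUpTo : ℕ → List ℕ
primesUpTo M = filter prime? (upTo (suc M))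

prodBelow : ℕ → ℚ
prodBelow p = go (filter (_<? p) (primesUpTo p))
  where
  go : List ℕ → ℚ
  go [] = 1ℚ
  go (q ∷ qs) = (1ℚ ℚ.- inv q) ℚ.* go qs

-- partial sum  Σ_{p ≤ M prime} 1/(p(p+1)) ∏_{p'<p} (1 - 1/p');
-- the constant c is the limit (= supremum) of these increasing partial sums.
cPartial : ℕ → ℚ
cPartial M = go (primesUpTo M)
  where
  go : List ℕ → ℚ
  go [] = 0ℚ
  go (p ∷ ps) = (inv (p Data.Nat.* suc p) ℚ.* prodBelow p) ℚ.+ go ps

-- L(n) = ⌊log₂ n⌋ · ⌊log₂ ⌊log₂ n⌋⌋, a stand-in for log n · log log n
-- (same order of magnitude up to constant factors for large n).
L : ℕ → ℕ
L n = ⌊log₂ n ⌋ Data.Nat.* ⌊log₂ ⌊log₂ n ⌋ ⌋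

toℚ : ℕ → ℚ
toℚ n = (+ n) ℚ./ 1

{-# OPTIONS --safe #-}
module Submission where

-- For a prime p, call u a p-modulus of n if ⌊n / u⌋ = p and u has no prime factor below p;
-- its remainder is n mod u = n − p u.  Remainders coming from different primes p < p′ differ,
-- since p u = p′ u′ would put p into u′.  Conversely, if r = n mod k with 2k ≤ n and p is the
-- least prime factor of n − r, then r comes from the p-modulus (n − r) / p, and p > y forces
-- r < n / y.  Hence s(n) is, up to n / y, the number of remainders coming from primes p ≤ y.
-- The p-moduli are the u ∈ (n / (p + 1), n / p] surviving the sieve by the primes below p;
-- Legendre's sieve counts them as n / (p (p + 1)) · ∏_{p′ < p} (1 − 1/p′) up to 2^π(p), and
-- the omitted tail of the series defining c is at most 1/y.  Taking y ≈ log n · log log n / 64,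
-- Chebyshev's bound π(y) = O(y / log y) keeps all the sieve errors below n / (log n log log n).

open import Defs

module Rationals where

  open import Data.Nat.Base as ℕ using (zero; suc)
  import Data.Nat.Properties as ℕ
  import Data.Nat.DivMod as ℕ
  open import Data.Nat.Coprimality using (1-coprimeTo) renaming (sym to coprime-sym)
  import Data.Integer.Base as ℤ
  import Data.Integer.Properties as ℤ
  open import Data.Rational.Base
  open import Data.Rational.Properties
  open import Data.Rational.Solver using (module +-*-Solver)
  open +-*-Solver using (solve; _:+_; _:*_; _:-_; con; _:=_)
  open import Data.Sum.Base using (inj₁; inj₂)
  open import Relation.Binary.PropositionalEquality

  0≤p∧0≤q⇒0≤p*q : ∀ {p q} → 0ℚ ≤ p → 0ℚ ≤ q → 0ℚ ≤ p * q
  0≤p∧0≤q⇒0≤p*q {p} {q} 0≤p 0≤q =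
    nonNegative⁻¹ (p * q) {{nonNeg*nonNeg⇒nonNeg p {{nonNegative 0≤p}} q {{nonNegative 0≤q}}}}

  *-monoˡ-≤-0≤ : ∀ {r p q} → 0ℚ ≤ r → p ≤ q → r * p ≤ r * q
  *-monoˡ-≤-0≤ {r} 0≤r = *-monoˡ-≤-nonNeg r {{nonNegative 0≤r}}

  *-monoʳ-≤-0≤ : ∀ {r p q} → 0ℚ ≤ r → p ≤ q → p * r ≤ q * r
  *-monoʳ-≤-0≤ {r} 0≤r = *-monoʳ-≤-nonNeg r {{nonNegative 0≤r}}

  p≤p+q : ∀ {p q} → 0ℚ ≤ q → p ≤ p + q
  p≤p+q {p} {q} 0≤q = subst (_≤ p + q) (+-identityʳ p) (+-monoʳ-≤ p 0≤q)

  p≤q⇒0≤q-p : ∀ {p q} → p ≤ q → 0ℚ ≤ q - p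
  p≤q⇒0≤q-p {p} {q} p≤q = subst (_≤ q - p) (+-inverseʳ p) (+-monoˡ-≤ (- p) p≤q)

  0≤q⇒p-q≤p : ∀ {p q} → 0ℚ ≤ q → p - q ≤ p
  0≤q⇒p-q≤p {p} {q} 0≤q = subst (p - q ≤_) (+-identityʳ p) (+-monoʳ-≤ p (neg-antimono-≤ 0≤q))

  p≤∣p∣ : ∀ p → p ≤ ∣ p ∣
  p≤∣p∣ p with ≤-total 0ℚ p
  ... | inj₁ 0≤p = ≤-reflexive (sym (0≤p⇒∣p∣≡p 0≤p))
  ... | inj₂ p≤0 = ≤-trans p≤0 (0≤∣p∣ p)

  -p≤∣p∣ : ∀ p → - p ≤ ∣ p ∣
  -p≤∣p∣ p = subst (- p ≤_) (∣-p∣≡∣p∣ p) (p≤∣p∣ (- p))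

  ∣p-q+r∣≤∣p∣+∣q∣+∣r∣ : ∀ p q r → ∣ p - q + r ∣ ≤ ∣ p ∣ + ∣ q ∣ + ∣ r ∣
  ∣p-q+r∣≤∣p∣+∣q∣+∣r∣ p q r = ≤-trans (∣p+q∣≤∣p∣+∣q∣ (p - q) r) (+-monoˡ-≤ ∣ r ∣ (∣p-q∣≤∣p∣+∣q∣ p q))

  toℚ≡mkℚ : ∀ n → toℚ n ≡ mkℚ (ℤ.+ n) 0 (coprime-sym (1-coprimeTo n))
  toℚ≡mkℚ n = normalize-coprime (coprime-sym (1-coprimeTo n))

  toℚ-suc : ∀ n → toℚ (suc n) ≡ 1ℚ + toℚ n
  toℚ-suc n rewrite toℚ≡mkℚ n | ℕ.*-identityʳ n | ℤ.+◃n≡+n n = refl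

  toℚ-+ : ∀ m n → toℚ (m ℕ.+ n) ≡ toℚ m + toℚ n
  toℚ-+ zero    n = sym (+-identityˡ (toℚ n))
  toℚ-+ (suc m) n = begin
    toℚ (suc (m ℕ.+ n))    ≡⟨ toℚ-suc (m ℕ.+ n) ⟩
    1ℚ + toℚ (m ℕ.+ n)     ≡⟨ cong (1ℚ +_) (toℚ-+ m n) ⟩
    1ℚ + (toℚ m + toℚ n)   ≡⟨ sym (+-assoc 1ℚ (toℚ m) (toℚ n)) ⟩
    (1ℚ + toℚ m) + toℚ n   ≡⟨ cong (_+ toℚ n) (sym (toℚ-suc m)) ⟩
    toℚ (suc m) + toℚ n    ∎
    where open ≡-Reasoning

  toℚ-* : ∀ m n → toℚ (m ℕ.* n) ≡ toℚ m * toℚ n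
  toℚ-* zero    n = sym (*-zeroˡ (toℚ n))
  toℚ-* (suc m) n = begin
    toℚ (n ℕ.+ m ℕ.* n)     ≡⟨ toℚ-+ n (m ℕ.* n) ⟩
    toℚ n + toℚ (m ℕ.* n)   ≡⟨ cong (toℚ n +_) (toℚ-* m n) ⟩
    toℚ n + toℚ m * toℚ n   ≡⟨ distrib (toℚ m) (toℚ n) ⟩
    (1ℚ + toℚ m) * toℚ n    ≡⟨ cong (_* toℚ n) (sym (toℚ-suc m)) ⟩
    toℚ (suc m) * toℚ n     ∎
    where
    open ≡-Reasoning
    distrib : ∀ x y → y + x * y ≡ (1ℚ + x) * y
    distrib = solve 2 (λ x y → y :+ x :* y := (con 1ℚ :+ x) :* y) refl

  toℚ-mono-≤ : ∀ {m n} → m ℕ.≤ n → toℚ m ≤ toℚ n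
  toℚ-mono-≤ {m} {n} m≤n rewrite toℚ≡mkℚ m | toℚ≡mkℚ n =
    *≤* (ℤ.*-monoʳ-≤-nonNeg (ℤ.+ 1) (ℤ.+≤+ m≤n))

  toℚ-nonNeg : ∀ n → 0ℚ ≤ toℚ n
  toℚ-nonNeg n = toℚ-mono-≤ {0} {n} ℕ.z≤n

  inv≡mkℚ : ∀ k → inv (suc k) ≡ mkℚ (ℤ.+ 1) k (1-coprimeTo (suc k))
  inv≡mkℚ k = normalize-coprime (1-coprimeTo (suc k))

  inv-inverse : ∀ q .{{_ : ℕ.NonZero q}} → inv q * toℚ q ≡ 1ℚ
  inv-inverse (suc k) rewrite inv≡mkℚ k | toℚ≡mkℚ (suc k) =
    *-inverseˡ (mkℚ (ℤ.+ suc k) 0 (coprime-sym (1-coprimeTo (suc k))))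

  inv-nonNeg : ∀ q → 0ℚ ≤ inv q
  inv-nonNeg zero    = ≤-refl
  inv-nonNeg (suc k) rewrite inv≡mkℚ k = *≤* (ℤ.+≤+ ℕ.z≤n)

  inv≤1 : ∀ q → inv q ≤ 1ℚ
  inv≤1 zero    = *≤* (ℤ.+≤+ ℕ.z≤n)
  inv≤1 (suc k) = begin
    inv (suc k)                  ≡⟨ sym (*-identityʳ (inv (suc k))) ⟩
    inv (suc k) * 1ℚ             ≤⟨ *-monoˡ-≤-0≤ (inv-nonNeg (suc k)) (toℚ-mono-≤ {1} {suc k} (ℕ.s≤s ℕ.z≤n)) ⟩
    inv (suc k) * toℚ (suc k)    ≡⟨ inv-inverse (suc k) ⟩
    1ℚ                           ∎
    where open ≤-Reasoning

  partial-fraction : ∀ a b c x → a * x ≡ 1ℚ → b * (1ℚ + x) ≡ 1ℚ → c * (x * (1ℚ + x)) ≡ 1ℚ →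
                     c ≡ a - b
  partial-fraction a b c x ax≡1 bx′≡1 cxx′≡1 = begin
    c                                 ≡⟨ *1*1 c ⟩
    c * (1ℚ * 1ℚ)                     ≡⟨ cong (c *_) (sym (cong₂ _*_ ax≡1 bx′≡1)) ⟩
    c * ((a * x) * (b * (1ℚ + x)))    ≡⟨ regroup a b c x ⟩
    (a * b) * (c * (x * (1ℚ + x)))    ≡⟨ cong ((a * b) *_) cxx′≡1 ⟩
    (a * b) * 1ℚ                      ≡⟨ expand a b x ⟩
    a * (b * (1ℚ + x)) - b * (a * x)  ≡⟨ cong₂ (λ s t → a * s - b * t) bx′≡1 ax≡1 ⟩
    a * 1ℚ - b * 1ℚ                   ≡⟨ *1-*1 a b ⟩
    a - b                             ∎
    where
    open ≡-Reasoning
    *1*1 : ∀ c → c ≡ c * (1ℚ * 1ℚ)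
    *1*1 = solve 1 (λ c → c := c :* (con 1ℚ :* con 1ℚ)) refl
    regroup : ∀ a b c x → c * ((a * x) * (b * (1ℚ + x))) ≡ (a * b) * (c * (x * (1ℚ + x)))
    regroup = solve 4 (λ a b c x → c :* ((a :* x) :* (b :* (con 1ℚ :+ x))) :=
                                   (a :* b) :* (c :* (x :* (con 1ℚ :+ x)))) refl
    expand : ∀ a b x → (a * b) * 1ℚ ≡ a * (b * (1ℚ + x)) - b * (a * x)
    expand = solve 3 (λ a b x → (a :* b) :* con 1ℚ := a :* (b :* (con 1ℚ :+ x)) :- b :* (a :* x)) refl
    *1-*1 : ∀ a b → a * 1ℚ - b * 1ℚ ≡ a - b
    *1-*1 = solve 2 (λ a b → a :* con 1ℚ :- b :* con 1ℚ := a :- b) refl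

  inv-*-suc : ∀ q .{{_ : ℕ.NonZero q}} → inv (q ℕ.* suc q) ≡ inv q - inv (suc q)
  inv-*-suc q = partial-fraction (inv q) (inv (suc q)) (inv (q ℕ.* suc q)) (toℚ q) (inv-inverse q)
    (trans (cong (inv (suc q) *_) (sym (toℚ-suc q))) (inv-inverse (suc q)))
    (trans (cong (inv (q ℕ.* suc q) *_) (sym (trans (toℚ-* q (suc q)) (cong (toℚ q *_) (toℚ-suc q)))))
           (inv-inverse (q ℕ.* suc q) {{ℕ.m*n≢0 q (suc q)}}))

  inv-suc≤inv : ∀ q .{{_ : ℕ.NonZero q}} → inv (suc q) ≤ inv q
  inv-suc≤inv q = begin
    inv (suc q)                           ≡⟨ sym (+-identityˡ (inv (suc q))) ⟩
    0ℚ + inv (suc q)                      ≤⟨ +-monoˡ-≤ (inv (suc q)) (inv-nonNeg (q ℕ.* suc q)) ⟩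
    inv (q ℕ.* suc q) + inv (suc q)       ≡⟨ cong (_+ inv (suc q)) (inv-*-suc q) ⟩
    (inv q - inv (suc q)) + inv (suc q)   ≡⟨ cancel (inv q) (inv (suc q)) ⟩
    inv q                                 ∎
    where
    open ≤-Reasoning
    cancel : ∀ a b → (a - b) + b ≡ a
    cancel = solve 2 (λ a b → (a :- b) :+ b := a) refl

  m≤o*n⇒inv[n]*m≤o : ∀ {m n o} .{{_ : ℕ.NonZero n}} → m ℕ.≤ o ℕ.* n → inv n * toℚ m ≤ toℚ o
  m≤o*n⇒inv[n]*m≤o {m} {n} {o} m≤o*n = begin
    inv n * toℚ m               ≤⟨ *-monoˡ-≤-0≤ (inv-nonNeg n) (toℚ-mono-≤ m≤o*n) ⟩
    inv n * toℚ (o ℕ.* n)       ≡⟨ cong (inv n *_) (toℚ-* o n) ⟩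
    inv n * (toℚ o * toℚ n)     ≡⟨ swap (inv n) (toℚ o) (toℚ n) ⟩
    toℚ o * (inv n * toℚ n)     ≡⟨ cong (toℚ o *_) (inv-inverse n) ⟩
    toℚ o * 1ℚ                  ≡⟨ *-identityʳ (toℚ o) ⟩
    toℚ o                       ∎
    where
    open ≤-Reasoning
    swap : ∀ i a b → i * (a * b) ≡ a * (i * b)
    swap = solve 3 (λ i a b → i :* (a :* b) := a :* (i :* b)) refl

  floor-error : ∀ x q .{{_ : ℕ.NonZero q}} → ∣ toℚ x * inv q - toℚ (x ℕ./ q) ∣ ≤ 1ℚ
  floor-error x q = begin
    ∣ toℚ x * inv q - d ∣   ≡⟨ cong ∣_∣ fractionalPart ⟩
    ∣ r * inv q ∣           ≡⟨ 0≤p⇒∣p∣≡p (0≤p∧0≤q⇒0≤p*q (toℚ-nonNeg (x ℕ.% q)) (inv-nonNeg q)) ⟩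
    r * inv q               ≤⟨ *-monoʳ-≤-0≤ (inv-nonNeg q) (toℚ-mono-≤ (ℕ.<⇒≤ (ℕ.m%n<n x q))) ⟩
    toℚ q * inv q           ≡⟨ trans (*-comm (toℚ q) (inv q)) (inv-inverse q) ⟩
    1ℚ                      ∎
    where
    open ≤-Reasoning
    r d : ℚ
    r = toℚ (x ℕ.% q)
    d = toℚ (x ℕ./ q)
    expand : ∀ r d Q i → (r + d * Q) * i - d ≡ r * i + d * (i * Q - 1ℚ)
    expand = solve 4 (λ r d Q i → (r :+ d :* Q) :* i :- d := r :* i :+ d :* (i :* Q :- con 1ℚ)) refl
    simplify : ∀ r d i → r * i + d * (1ℚ - 1ℚ) ≡ r * i
    simplify = solve 3 (λ r d i → r :* i :+ d :* (con 1ℚ :- con 1ℚ) := r :* i) refl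
    fractionalPart : toℚ x * inv q - d ≡ r * inv q
    fractionalPart = begin-equality
      toℚ x * inv q - d
        ≡⟨ cong (λ t → toℚ t * inv q - d) (ℕ.m≡m%n+[m/n]*n x q) ⟩
      toℚ (x ℕ.% q ℕ.+ x ℕ./ q ℕ.* q) * inv q - d
        ≡⟨ cong (λ t → t * inv q - d) (trans (toℚ-+ (x ℕ.% q) _) (cong (r +_) (toℚ-* (x ℕ./ q) q))) ⟩
      (r + d * toℚ q) * inv q - d
        ≡⟨ expand r d (toℚ q) (inv q) ⟩
      r * inv q + d * (inv q * toℚ q - 1ℚ)
        ≡⟨ cong (λ t → r * inv q + d * (t - 1ℚ)) (inv-inverse q) ⟩
      r * inv q + d * (1ℚ - 1ℚ)
        ≡⟨ simplify r d (inv q) ⟩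
      r * inv q                                ∎

module Lists where

  open import Data.Nat.Base using (ℕ; zero; suc; _+_; _≤_; _<_; z≤n; s≤s)
  open import Data.Nat.Properties
  open import Data.List.Base using (List; []; _∷_; _++_; length; upTo; applyUpTo; map; concatMap)
  open import Data.List.Properties using (length-++)
  open import Data.List.Membership.Propositional using (_∈_; find)
  open import Data.List.Membership.Propositional.Properties
    using (∈-∃++; ∈-++⁻; ∈-++⁺ˡ; ∈-++⁺ʳ; ∈-map⁻; ∈-concatMap⁻)
  open import Data.List.Relation.Unary.Any using (here; there)
  import Data.List.Relation.Unary.All as All
  open import Data.List.Relation.Unary.Unique.Propositional using (Unique; []; _∷_)
  import Data.List.Relation.Unary.Unique.Propositional.Properties as Unique
  open import Data.List.Relation.Binary.Subset.Propositional using (_⊆_)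
  open import Data.List.Relation.Binary.Disjoint.Propositional using (Disjoint)
  open import Data.Product.Base using (_×_; _,_; proj₁)
  open import Data.Sum.Base using (inj₁; inj₂)
  open import Function.Base using (_∘_; id)
  open import Relation.Nullary using (yes; no; contradiction)
  open import Relation.Binary.PropositionalEquality

  interval : ℕ → ℕ → List ℕ
  interval a zero    = []
  interval a (suc k) = a ∷ interval (suc a) k

  interval-++ : ∀ a k l → interval a (k + l) ≡ interval a k ++ interval (a + k) l
  interval-++ a zero    l = cong (λ b → interval b l) (sym (+-identityʳ a))
  interval-++ a (suc k) l = cong (a ∷_) (trans (interval-++ (suc a) k l)
    (cong (λ b → interval (suc a) k ++ interval b l) (sym (+-suc a k))))

  length-interval : ∀ a k → length (interval a k) ≡ k
  length-interval a zero    = refl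
  length-interval a (suc k) = cong suc (length-interval (suc a) k)

  ∈-interval⁻ : ∀ {x} a k → x ∈ interval a k → a ≤ x × x < a + k
  ∈-interval⁻ a (suc k) (here refl) = ≤-refl , m<m+n a (s≤s z≤n)
  ∈-interval⁻ {x} a (suc k) (there x∈) with ∈-interval⁻ (suc a) k x∈
  ... | a<x , x<a+1+k = <⇒≤ a<x , subst (x <_) (sym (+-suc a k)) x<a+1+k

  ∈-interval⁺ : ∀ {x} a k → a ≤ x → x < a + k → x ∈ interval a k
  ∈-interval⁺ {x} a zero    a≤x x<a+0 = contradiction a≤x (<⇒≱ (subst (x <_) (+-identityʳ a) x<a+0))
  ∈-interval⁺ {x} a (suc k) a≤x x<a+k with a ≟ x
  ... | yes refl = here refl
  ... | no  a≢x  = there (∈-interval⁺ (suc a) k (≤∧≢⇒< a≤x a≢x) (subst (x <_) (+-suc a k) x<a+k))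

  interval-unique : ∀ a k → Unique (interval a k)
  interval-unique a zero    = []
  interval-unique a (suc k) =
    All.tabulate (λ x∈ → <⇒≢ (proj₁ (∈-interval⁻ (suc a) k x∈))) ∷ interval-unique (suc a) k

  applyUpTo≡interval : ∀ (f : ℕ → ℕ) a → (∀ i → f i ≡ a + i) → ∀ k → applyUpTo f k ≡ interval a k
  applyUpTo≡interval f a f≗a+ zero    = refl
  applyUpTo≡interval f a f≗a+ (suc k) = cong₂ _∷_ (trans (f≗a+ 0) (+-identityʳ a))
    (applyUpTo≡interval (f ∘ suc) (suc a) (λ i → trans (f≗a+ (suc i)) (+-suc a i)) k)

  upTo≡interval : ∀ k → upTo k ≡ interval 0 k
  upTo≡interval = applyUpTo≡interval id 0 (λ _ → refl)

  module _ {a} {A : Set a} where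

    unique⊆⇒length≤ : ∀ {xs ys : List A} → Unique xs → xs ⊆ ys → length xs ≤ length ys
    unique⊆⇒length≤ {[]}     _            _       = z≤n
    unique⊆⇒length≤ {x ∷ xs} (x∉xs ∷ !xs) x∷xs⊆ys with ∈-∃++ (x∷xs⊆ys (here refl))
    ... | ys₁ , ys₂ , refl = begin
      suc (length xs)                 ≤⟨ s≤s (unique⊆⇒length≤ !xs xs⊆ys₁++ys₂) ⟩
      suc (length (ys₁ ++ ys₂))       ≡⟨ cong suc (length-++ ys₁) ⟩
      suc (length ys₁ + length ys₂)   ≡⟨ sym (+-suc (length ys₁) (length ys₂)) ⟩
      length ys₁ + length (x ∷ ys₂)   ≡⟨ sym (length-++ ys₁) ⟩
      length (ys₁ ++ x ∷ ys₂)         ∎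
      where
      open ≤-Reasoning
      xs⊆ys₁++ys₂ : xs ⊆ ys₁ ++ ys₂
      xs⊆ys₁++ys₂ {v} v∈xs with ∈-++⁻ ys₁ (x∷xs⊆ys (there v∈xs))
      ... | inj₁ v∈ys₁         = ∈-++⁺ˡ v∈ys₁
      ... | inj₂ (here refl)   = contradiction refl (All.lookup x∉xs v∈xs)
      ... | inj₂ (there v∈ys₂) = ∈-++⁺ʳ ys₁ v∈ys₂

    unique-⊆-⊇⇒length≡ : ∀ {xs ys : List A} → Unique xs → Unique ys → xs ⊆ ys → ys ⊆ xs →
                         length xs ≡ length ys
    unique-⊆-⊇⇒length≡ !xs !ys xs⊆ys ys⊆xs =
      ≤-antisym (unique⊆⇒length≤ !xs xs⊆ys) (unique⊆⇒length≤ !ys ys⊆xs)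

    module _ {b} {B : Set b} where

      map-unique : ∀ {f : A → B} {xs} → (∀ {x y} → x ∈ xs → y ∈ xs → f x ≡ f y → x ≡ y) →
                   Unique xs → Unique (map f xs)
      map-unique {f} {[]}     _           []           = []
      map-unique {f} {x ∷ xs} f-injective (x∉xs ∷ !xs) =
        All.tabulate fx∉ ∷ map-unique (λ x∈ y∈ → f-injective (there x∈) (there y∈)) !xs
        where
        fx∉ : ∀ {z} → z ∈ map f xs → f x ≢ z
        fx∉ z∈ fx≡z with ∈-map⁻ f z∈
        ... | y , y∈xs , refl = All.lookup x∉xs y∈xs (f-injective (here refl) (there y∈xs) fx≡z)

      concatMap-unique : ∀ {f : A → List B} {xs} → Unique xs → (∀ {x} → x ∈ xs → Unique (f x)) →
                         (∀ {x y} → x ∈ xs → y ∈ xs → x ≢ y → Disjoint (f x) (f y)) →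
                         Unique (concatMap f xs)
      concatMap-unique {f} {[]}     _            _      _        = []
      concatMap-unique {f} {x ∷ xs} (x∉xs ∷ !xs) !f[xs] disjoint =
        Unique.++⁺ (!f[xs] (here refl))
          (concatMap-unique !xs (!f[xs] ∘ there) (λ x∈ y∈ → disjoint (there x∈) (there y∈)))
          f[x]-disjoint
        where
        f[x]-disjoint : Disjoint (f x) (concatMap f xs)
        f[x]-disjoint (z∈f[x] , z∈concat) with find (∈-concatMap⁻ f z∈concat)
        ... | y , y∈xs , z∈f[y] =
          disjoint (here refl) (there y∈xs) (All.lookup x∉xs y∈xs) (z∈f[x] , z∈f[y])

module Division where

  open import Data.Nat.Base using (suc; _+_; _*_; _≤_; _<_; NonZero)
  open import Data.Nat.Properties
  open import Data.Nat.DivMod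
  open import Relation.Binary.PropositionalEquality

  m*n≤o⇒m≤o/n : ∀ m {n o} .{{_ : NonZero n}} → m * n ≤ o → m ≤ o / n
  m*n≤o⇒m≤o/n m {n} m*n≤o = subst (_≤ _) (m*n/n≡m m n) (/-monoˡ-≤ n m*n≤o)

  m≤o/n⇒m*n≤o : ∀ {m} n {o} .{{_ : NonZero n}} → m ≤ o / n → m * n ≤ o
  m≤o/n⇒m*n≤o n {o} m≤o/n = ≤-trans (*-monoˡ-≤ n m≤o/n) (m/n*n≤m o n)

  m<[1+m/n]*n : ∀ m n .{{_ : NonZero n}} → m < suc (m / n) * n
  m<[1+m/n]*n m n = begin-strict
    m                     ≡⟨ m≡m%n+[m/n]*n m n ⟩
    m % n + (m / n) * n   <⟨ +-monoˡ-< ((m / n) * n) (m%n<n m n) ⟩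
    suc (m / n) * n       ∎
    where open ≤-Reasoning

module Primes where

  open Lists
  open import Data.Nat.Base using (ℕ; zero; suc; _+_; _∸_; _≤_; _<_; s≤s; s≤s⁻¹; n>1⇒nonTrivial; nonTrivial⇒n>1)
  open import Data.Nat.Properties
    using (<⇒≤; _<?_; +-suc; m≤n⇒m≤1+n; ≮⇒≥; m∸n+n≡m; m+[n∸m]≡n; m≤m+n; ≤-refl; module ≤-Reasoning)
  open import Data.Nat.Divisibility using (_∣_; _∣?_; ∣-refl)
  open import Data.Nat.Divisibility.Core using (hasNonTrivialDivisor)
  open import Data.Nat.Primality
    using (Prime; prime?; prime⇒irreducible; prime⇒nonTrivial; ¬prime[1];
           _Rough_; 2-rough; ∤⇒rough-suc; rough∧∣⇒prime)
  open import Data.List.Base using (List; _++_; filter; upTo; length)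
  open import Data.List.Properties using (filter-++; length-++; length-filter)
  open import Data.List.Membership.Propositional using (_∈_)
  open import Data.List.Membership.Propositional.Properties using (∈-filter⁺; ∈-filter⁻; ∈-upTo⁺; ∈-upTo⁻)
  open import Data.List.Relation.Unary.All as All using (All)
  open import Data.List.Relation.Unary.Unique.Propositional using (Unique)
  import Data.List.Relation.Unary.Unique.Propositional.Properties as Unique
  open import Data.Product.Base using (_×_; _,_; proj₁; ∃-syntax)
  open import Data.Sum.Base using (inj₁; inj₂)
  open import Relation.Nullary using (yes; no; contradiction)
  open import Relation.Binary.PropositionalEquality

  prime∣prime⇒≡ : ∀ {p q} → Prime p → Prime q → p ∣ q → p ≡ q
  prime∣prime⇒≡ p-prime q-prime p∣q with prime⇒irreducible q-prime p∣q
  ... | inj₁ refl = contradiction p-prime ¬prime[1]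
  ... | inj₂ p≡q  = p≡q

  prime⇒2≤ : ∀ {p} → Prime p → 2 ≤ p
  prime⇒2≤ {p} p-prime = nonTrivial⇒n>1 p {{prime⇒nonTrivial p-prime}}

  leastPrimeFactor : ∀ m → 2 ≤ m → ∃[ p ] Prime p × p ∣ m × p Rough m
  leastPrimeFactor m 2≤m = search _ 2 (m∸n+n≡m 2≤m) ≤-refl 2-rough
    where
    -- trial division by d = 2, 3, …; the fuel k = m - d bounds the search
    search : ∀ k d → k + d ≡ m → 2 ≤ d → d Rough m → ∃[ p ] Prime p × p ∣ m × p Rough m
    search k d _ 2≤d d-rough with d ∣? m
    search k       d _     2≤d d-rough | yes d∣m =
      d , rough∧∣⇒prime {{n>1⇒nonTrivial 2≤d}} d-rough d∣m , d∣m , d-rough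
    search zero    d refl  2≤d d-rough | no  d∤m = contradiction ∣-refl d∤m
    search (suc k) d k+d≡m 2≤d d-rough | no  d∤m =
      search k (suc d) (trans (+-suc k d) k+d≡m) (m≤n⇒m≤1+n 2≤d) (∤⇒rough-suc d∤m d-rough)

  rough-∣⇒≤ : ∀ {p m d} → p Rough m → 2 ≤ d → d ∣ m → p ≤ d
  rough-∣⇒≤ {p} {m} {d} p-rough 2≤d d∣m with d <? p
  ... | yes d<p = contradiction (hasNonTrivialDivisor {{n>1⇒nonTrivial 2≤d}} d<p d∣m) p-rough
  ... | no  d≮p = ≮⇒≥ d≮p

  ∈-primesUpTo⁻ : ∀ y {p} → p ∈ primesUpTo y → Prime p × p ≤ y
  ∈-primesUpTo⁻ y p∈ with ∈-filter⁻ prime? {xs = upTo (suc y)} p∈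
  ... | p∈upTo , p-prime = p-prime , s≤s⁻¹ (∈-upTo⁻ p∈upTo)

  ∈-primesUpTo⁺ : ∀ {p y} → Prime p → p ≤ y → p ∈ primesUpTo y
  ∈-primesUpTo⁺ p-prime p≤y = ∈-filter⁺ prime? (∈-upTo⁺ (s≤s p≤y)) p-prime

  primesUpTo-unique : ∀ y → Unique (primesUpTo y)
  primesUpTo-unique y = Unique.filter⁺ prime? (Unique.upTo⁺ (suc y))

  primesUpTo-+ : ∀ a k → primesUpTo (a + k) ≡ primesUpTo a ++ filter prime? (interval (suc a) k)
  primesUpTo-+ a k = begin
    filter prime? (upTo (suc a + k))
      ≡⟨ cong (filter prime?) (trans (upTo≡interval (suc a + k)) (interval-++ 0 (suc a) k)) ⟩
    filter prime? (interval 0 (suc a) ++ interval (suc a) k)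
      ≡⟨ filter-++ prime? (interval 0 (suc a)) (interval (suc a) k) ⟩
    filter prime? (interval 0 (suc a)) ++ filter prime? (interval (suc a) k)
      ≡⟨ cong (λ xs → filter prime? xs ++ filter prime? (interval (suc a) k)) (sym (upTo≡interval (suc a))) ⟩
    primesUpTo a ++ filter prime? (interval (suc a) k)
      ∎
    where open ≡-Reasoning

  π : ℕ → ℕ
  π y = length (primesUpTo y)

  π-mono-≤ : ∀ {a b} → a ≤ b → π a ≤ π b
  π-mono-≤ {a} {b} a≤b = begin
    π a                                                        ≤⟨ m≤m+n (π a) _ ⟩
    π a + length (filter prime? (interval (suc a) (b ∸ a)))    ≡⟨ sym (length-++ (primesUpTo a)) ⟩
    length (primesUpTo a ++ filter prime? (interval (suc a) (b ∸ a)))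
                                                               ≡⟨ cong length (sym (primesUpTo-+ a (b ∸ a))) ⟩
    π (a + (b ∸ a))                                            ≡⟨ cong π (m+[n∸m]≡n a≤b) ⟩
    π b                                                        ∎
    where open ≤-Reasoning

  primesBelow : ℕ → List ℕ
  primesBelow p = filter (_<? p) (primesUpTo p)

  ∈-primesBelow⁻ : ∀ p {q} → q ∈ primesBelow p → Prime q × q < p
  ∈-primesBelow⁻ p q∈ with ∈-filter⁻ (_<? p) {xs = primesUpTo p} q∈
  ... | q∈primesUpTo , q<p = proj₁ (∈-primesUpTo⁻ p q∈primesUpTo) , q<p

  ∈-primesBelow⁺ : ∀ {q p} → Prime q → q < p → q ∈ primesBelow p
  ∈-primesBelow⁺ q-prime q<p = ∈-filter⁺ (_<? _) (∈-primesUpTo⁺ q-prime (<⇒≤ q<p)) q<p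

  primesBelow-primes : ∀ p → All Prime (primesBelow p)
  primesBelow-primes p = All.tabulate (λ q∈ → proj₁ (∈-primesBelow⁻ p q∈))

  primesBelow-unique : ∀ p → Unique (primesBelow p)
  primesBelow-unique p = Unique.filter⁺ (_<? p) (primesUpTo-unique p)

  length-primesBelow≤π : ∀ p → length (primesBelow p) ≤ π p
  length-primesBelow≤π p = length-filter (_<? p) (primesUpTo p)

module Sieve where

  open Rationals
  open Lists
  open Division
  open Primes
  open import Data.Nat.Base as ℕ using (ℕ; suc; _^_; NonZero; z≤n; s≤s; s≤s⁻¹)
  import Data.Nat.Properties as ℕ
  open import Data.Nat.DivMod using (_/_)
  open import Data.Nat.Divisibility using (_∣_; _∣?_; divides; ∣-trans; m∣m*n)
  open import Data.Nat.Primality using (Prime; euclidsLemma; prime⇒nonZero)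
  open import Data.List.Base using (List; []; _∷_; _++_; length; filter; map; foldr)
  open import Data.List.Properties using (length-++; length-map; filter-all)
  open import Data.List.Membership.Propositional using (_∈_; _∉_)
  open import Data.List.Membership.Propositional.Properties
    using (∈-filter⁺; ∈-filter⁻; ∈-map⁺; ∈-map⁻; ∈-++⁺ˡ; ∈-++⁺ʳ; ∈-++⁻)
  open import Data.List.Relation.Unary.All as All using (All; []; _∷_)
  open import Data.List.Relation.Unary.Unique.Propositional using (Unique; _∷_)
  import Data.List.Relation.Unary.Unique.Propositional.Properties as Unique
  open import Data.List.Relation.Binary.Disjoint.Propositional using (Disjoint)
  open import Data.Product.Base using (_×_; _,_; proj₁; proj₂)
  open import Data.Sum.Base using (inj₁; inj₂)
  open import Data.Rational.Base using (ℚ; 0ℚ; 1ℚ; _+_; _*_; _-_; _≤_; ∣_∣)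
  open import Data.Rational.Properties
  open import Data.Rational.Solver using (module +-*-Solver)
  open +-*-Solver using (solve; _:+_; _:*_; _:-_; con; _:=_)
  open import Relation.Nullary using (¬_; ¬?; yes; no)
  open import Relation.Unary using (Decidable)
  open import Relation.Binary.PropositionalEquality

  Sifted : List ℕ → ℕ → Set
  Sifted P u = All (λ q → ¬ q ∣ u) P

  sifted? : ∀ P → Decidable (Sifted P)
  sifted? P u = All.all? (λ q → ¬? (q ∣? u)) P

  sifted-∣ : ∀ {P d u} → d ∣ u → Sifted P u → Sifted P d
  sifted-∣ d∣u = All.map (λ q∤u q∣d → q∤u (∣-trans q∣d d∣u))

  sifted-* : ∀ {P q v} → All Prime P → Prime q → q ∉ P → Sifted P v → Sifted P (q ℕ.* v)
  sifted-* {P} {q} {v} P-primes q-prime q∉P v-sifted = All.tabulate p∤qv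
    where
    p∤qv : ∀ {p} → p ∈ P → ¬ p ∣ q ℕ.* v
    p∤qv {p} p∈P p∣qv with euclidsLemma q v (All.lookup P-primes p∈P) p∣qv
    ... | inj₁ p∣q = q∉P (subst (_∈ P) (prime∣prime⇒≡ (All.lookup P-primes p∈P) q-prime p∣q) p∈P)
    ... | inj₂ p∣v = All.lookup v-sifted p∈P p∣v

  φ : List ℕ → ℕ → ℕ
  φ P x = length (filter (sifted? P) (interval 1 x))

  φ-[] : ∀ x → φ [] x ≡ x
  φ-[] x = trans (cong length (filter-all (sifted? []) {interval 1 x} (All.tabulate (λ _ → []))))
                 (length-interval 1 x)

  module _ {q P} (q-prime : Prime q) (P-primes : All Prime P) (q∉P : q ∉ P) where

    private instance
      q≢0 : NonZero q
      q≢0 = prime⇒nonZero q-prime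

    -- the survivors of P up to x are the survivors of q ∷ P up to x together with
    -- q times the survivors of P up to x / q
    φ-∷ : ∀ x → φ (q ∷ P) x ℕ.+ φ P (x / q) ≡ φ P x
    φ-∷ x = begin
      φ (q ∷ P) x ℕ.+ φ P (x / q)               ≡⟨ cong (φ (q ∷ P) x ℕ.+_) (sym (length-map (q ℕ.*_) small)) ⟩
      length coprime ℕ.+ length multiples       ≡⟨ sym (length-++ coprime) ⟩
      length (coprime ++ multiples)             ≡⟨ unique-⊆-⊇⇒length≡ !coprime++multiples !survivors ⊆ ⊇ ⟩
      φ P x                                     ∎
      where
      open ≡-Reasoning
      coprime small multiples survivors : List ℕ
      coprime   = filter (sifted? (q ∷ P)) (interval 1 x)
      small     = filter (sifted? P) (interval 1 (x / q))
      multiples = map (q ℕ.*_) small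
      survivors = filter (sifted? P) (interval 1 x)

      disjoint : Disjoint coprime multiples
      disjoint (u∈coprime , u∈multiples) with ∈-map⁻ (q ℕ.*_) u∈multiples
      ... | v , _ , refl = All.head (proj₂ (∈-filter⁻ (sifted? (q ∷ P)) {xs = interval 1 x} u∈coprime)) (m∣m*n v)

      !coprime++multiples : Unique (coprime ++ multiples)
      !coprime++multiples = Unique.++⁺ (Unique.filter⁺ (sifted? (q ∷ P)) (interval-unique 1 x))
        (Unique.map⁺ (ℕ.*-cancelˡ-≡ _ _ q) (Unique.filter⁺ (sifted? P) (interval-unique 1 (x / q))))
        disjoint

      !survivors : Unique survivors
      !survivors = Unique.filter⁺ (sifted? P) (interval-unique 1 x)

      ⊆ : ∀ {u} → u ∈ coprime ++ multiples → u ∈ survivors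
      ⊆ {u} u∈ with ∈-++⁻ coprime u∈
      ... | inj₁ u∈coprime with ∈-filter⁻ (sifted? (q ∷ P)) {xs = interval 1 x} u∈coprime
      ...   | u∈[1,x] , _ ∷ u-sifted = ∈-filter⁺ (sifted? P) u∈[1,x] u-sifted
      ⊆ {u} u∈ | inj₂ u∈multiples with ∈-map⁻ (q ℕ.*_) u∈multiples
      ...   | v , v∈small , refl with ∈-filter⁻ (sifted? P) {xs = interval 1 (x / q)} v∈small
      ...     | v∈[1,x/q] , v-sifted with ∈-interval⁻ 1 (x / q) v∈[1,x/q]
      ...       | 1≤v , v<1+x/q = ∈-filter⁺ (sifted? P)
                    (∈-interval⁺ 1 x (ℕ.*-mono-≤ (ℕ.>-nonZero⁻¹ q) 1≤v) (s≤s qv≤x))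
                    (sifted-* P-primes q-prime q∉P v-sifted)
        where
        qv≤x : q ℕ.* v ℕ.≤ x
        qv≤x = subst (ℕ._≤ x) (ℕ.*-comm v q) (m≤o/n⇒m*n≤o q (s≤s⁻¹ v<1+x/q))

      ⊇ : ∀ {u} → u ∈ survivors → u ∈ coprime ++ multiples
      ⊇ {u} u∈survivors with ∈-filter⁻ (sifted? P) {xs = interval 1 x} u∈survivors
      ... | u∈[1,x] , u-sifted with q ∣? u
      ...   | no  q∤u = ∈-++⁺ˡ (∈-filter⁺ (sifted? (q ∷ P)) u∈[1,x] (q∤u ∷ u-sifted))
      ...   | yes (divides v refl) with ∈-interval⁻ 1 x u∈[1,x]
      ...     | 1≤vq , vq<1+x = ∈-++⁺ʳ coprime (subst (_∈ multiples) (ℕ.*-comm q v)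
                  (∈-map⁺ (q ℕ.*_) (∈-filter⁺ (sifted? P) v∈[1,x/q] (sifted-∣ (m∣m*n q) u-sifted))))
        where
        positive-factor : ∀ v → 1 ℕ.≤ v ℕ.* q → 1 ℕ.≤ v
        positive-factor (suc v) _ = s≤s z≤n
        v∈[1,x/q] : v ∈ interval 1 (x / q)
        v∈[1,x/q] = ∈-interval⁺ 1 (x / q) (positive-factor v 1≤vq) (s≤s (m*n≤o⇒m≤o/n v (s≤s⁻¹ vq<1+x)))

  density : List ℕ → ℚ
  density = foldr (λ q δ → (1ℚ - inv q) * δ) 1ℚ

  density-bounds : ∀ P → 0ℚ ≤ density P × density P ≤ 1ℚ
  density-bounds []      = toℚ-nonNeg 1 , ≤-refl
  density-bounds (q ∷ P) with density-bounds P
  ... | 0≤δ , δ≤1 = 0≤p∧0≤q⇒0≤p*q (p≤q⇒0≤q-p (inv≤1 q)) 0≤δ , (begin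
    (1ℚ - inv q) * density P   ≤⟨ *-monoʳ-≤-0≤ 0≤δ (0≤q⇒p-q≤p {1ℚ} (inv-nonNeg q)) ⟩
    1ℚ * density P             ≡⟨ *-identityˡ (density P) ⟩
    density P                  ≤⟨ δ≤1 ⟩
    1ℚ                         ∎)
    where open ≤-Reasoning

  rounding-error : ∀ x q .{{_ : NonZero q}} P → ∣ (toℚ x * inv q - toℚ (x / q)) * density P ∣ ≤ 1ℚ
  rounding-error x q P = begin
    ∣ e * δ ∣       ≡⟨ ∣p*q∣≡∣p∣*∣q∣ e δ ⟩
    ∣ e ∣ * ∣ δ ∣   ≡⟨ cong (∣ e ∣ *_) (0≤p⇒∣p∣≡p (proj₁ (density-bounds P))) ⟩
    ∣ e ∣ * δ       ≤⟨ *-monoˡ-≤-0≤ (0≤∣p∣ e) (proj₂ (density-bounds P)) ⟩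
    ∣ e ∣ * 1ℚ      ≡⟨ *-identityʳ ∣ e ∣ ⟩
    ∣ e ∣           ≤⟨ floor-error x q ⟩
    1ℚ              ∎
    where
    open ≤-Reasoning
    e δ : ℚ
    e = toℚ x * inv q - toℚ (x / q)
    δ = density P

  legendre : ∀ P → All Prime P → Unique P → ∀ x →
             ∣ toℚ (φ P x) - toℚ x * density P ∣ ≤ toℚ (2 ^ length P) - 1ℚ
  legendre [] _ _ x = ≤-reflexive (begin
    ∣ toℚ (φ [] x) - toℚ x * 1ℚ ∣   ≡⟨ cong (λ t → ∣ toℚ t - toℚ x * 1ℚ ∣) (φ-[] x) ⟩
    ∣ toℚ x - toℚ x * 1ℚ ∣          ≡⟨ cong ∣_∣ (cancel (toℚ x)) ⟩
    0ℚ                              ∎)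
    where
    open ≡-Reasoning
    cancel : ∀ a → a - a * 1ℚ ≡ 0ℚ
    cancel = solve 1 (λ a → a :- a :* con 1ℚ := con 0ℚ) refl
  legendre (q ∷ P) (q-prime ∷ P-primes) (q≢P ∷ !P) x = begin
    ∣ toℚ (φ (q ∷ P) x) - X * ((1ℚ - inv q) * δ) ∣
      ≡⟨ cong ∣_∣ decomposition ⟩
    ∣ (Φ - X * δ) - (Φ′ - D * δ) + (X * inv q - D) * δ ∣
      ≤⟨ ∣p-q+r∣≤∣p∣+∣q∣+∣r∣ (Φ - X * δ) (Φ′ - D * δ) ((X * inv q - D) * δ) ⟩
    ∣ Φ - X * δ ∣ + ∣ Φ′ - D * δ ∣ + ∣ (X * inv q - D) * δ ∣
      ≤⟨ +-mono-≤ (+-mono-≤ (legendre P P-primes !P x) (legendre P P-primes !P (x / q))) (rounding-error x q P) ⟩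
    (E - 1ℚ) + (E - 1ℚ) + 1ℚ
      ≡⟨ double E ⟩
    (1ℚ + 1ℚ) * E - 1ℚ
      ≡⟨ cong (_- 1ℚ) (sym (toℚ-* 2 (2 ^ length P))) ⟩
    toℚ (2 ^ length (q ∷ P)) - 1ℚ
      ∎
    where
    open ≤-Reasoning
    instance
      q≢0 : NonZero q
      q≢0 = prime⇒nonZero q-prime
    X D δ Φ Φ′ E : ℚ
    X  = toℚ x
    D  = toℚ (x / q)
    δ  = density P
    Φ  = toℚ (φ P x)
    Φ′ = toℚ (φ P (x / q))
    E  = toℚ (2 ^ length P)
    q∉P : q ∉ P
    q∉P q∈P = All.lookup q≢P q∈P refl
    φ-∷-ℚ : toℚ (φ (q ∷ P) x) + Φ′ ≡ Φ
    φ-∷-ℚ = trans (sym (toℚ-+ (φ (q ∷ P) x) (φ P (x / q)))) (cong toℚ (φ-∷ q-prime P-primes q∉P x))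
    rearrange : ∀ Φq Φ′ X D i δ → Φq - X * ((1ℚ - i) * δ) ≡
                ((Φq + Φ′) - X * δ) - (Φ′ - D * δ) + (X * i - D) * δ
    rearrange = solve 6 (λ Φq Φ′ X D i δ → Φq :- X :* ((con 1ℚ :- i) :* δ) :=
                                           ((Φq :+ Φ′) :- X :* δ) :- (Φ′ :- D :* δ) :+ (X :* i :- D) :* δ) refl
    decomposition : toℚ (φ (q ∷ P) x) - X * ((1ℚ - inv q) * δ) ≡
                    (Φ - X * δ) - (Φ′ - D * δ) + (X * inv q - D) * δ
    decomposition = trans (rearrange (toℚ (φ (q ∷ P) x)) Φ′ X D (inv q) δ)
                          (cong (λ t → (t - X * δ) - (Φ′ - D * δ) + (X * inv q - D) * δ) φ-∷-ℚ)
    double : ∀ E → (E - 1ℚ) + (E - 1ℚ) + 1ℚ ≡ (1ℚ + 1ℚ) * E - 1ℚ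
    double = solve 1 (λ E → (E :- con 1ℚ) :+ (E :- con 1ℚ) :+ con 1ℚ := (con 1ℚ :+ con 1ℚ) :* E :- con 1ℚ) refl

module Remainders where

  open Lists
  open Division
  open Primes
  open Sieve
  open import Data.Nat.Base using (ℕ; zero; suc; _+_; _*_; _∸_; _≤_; _<_; NonZero; z≤n; s≤s; s≤s⁻¹)
  open import Data.Nat.Properties
  open import Data.Nat.DivMod
    using (_/_; _%_; m≡m%n+[m/n]*n; m%n<n; m<n*o⇒m/o<n; /-monoʳ-≤; [m+kn]%n≡m%n; m<n⇒m%n≡m)
  open import Data.Nat.Divisibility using (_∣_; divides; ∣-trans; m∣m*n)
  open import Data.Nat.Divisibility.Core using (hasNonTrivialDivisor)
  open import Data.Nat.Primality using (Prime; _Rough_; euclidsLemma; prime⇒nonZero; prime⇒nonTrivial)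
  open import Data.List.Base using (List; []; _++_; length; filter; map; concatMap; upTo)
  open import Data.List.Properties using (length-++; length-map; filter-++; length-upTo)
  open import Data.List.Membership.Propositional using (_∈_; find; lose)
  open import Data.List.Membership.Propositional.Properties
    using (∈-filter⁺; ∈-filter⁻; ∈-map⁺; ∈-map⁻; ∈-upTo⁺; ∈-upTo⁻; ∈-++⁺ˡ; ∈-++⁺ʳ;
           ∈-concatMap⁺; ∈-concatMap⁻; ∈-deduplicate⁺; ∈-deduplicate⁻)
  import Data.List.Relation.Unary.All as All
  open import Data.List.Relation.Unary.Unique.Propositional using (Unique; [])
  import Data.List.Relation.Unary.Unique.Propositional.Properties as Unique
  open import Data.List.Relation.Unary.Unique.DecPropositional.Properties _≟_ using (deduplicate-!)
  open import Data.List.Relation.Binary.Disjoint.Propositional using (Disjoint)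
  open import Data.Product.Base using (_×_; _,_; proj₁; proj₂; ∃-syntax)
  open import Data.Sum.Base using (_⊎_; inj₁; inj₂; [_,_]′)
  open import Function.Base using (_∘_)
  open import Relation.Nullary using (yes; no; contradiction)
  open import Relation.Unary using (Decidable)
  open import Relation.Binary.Definitions using (tri<; tri≈; tri>)
  open import Relation.Binary.PropositionalEquality

  moduli : ℕ → ℕ → List ℕ
  moduli n zero      = []
  moduli n p@(suc _) = filter (sifted? (primesBelow p)) (interval (suc (n / suc p)) (n / p ∸ n / suc p))

  residues : ℕ → ℕ → List ℕ
  residues n p = map (λ u → n ∸ p * u) (moduli n p)

  ∈-moduli⁻ : ∀ n p {u} → u ∈ moduli n p → p * u ≤ n × n < suc p * u × Sifted (primesBelow p) u
  ∈-moduli⁻ n p@(suc _) {u} u∈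
    with ∈-filter⁻ (sifted? (primesBelow p)) {xs = interval (suc (n / suc p)) (n / p ∸ n / suc p)} u∈
  ... | u∈range , u-sifted with ∈-interval⁻ (suc (n / suc p)) (n / p ∸ n / suc p) u∈range
  ... | n/[p+1]<u , u<1+n/p = pu≤n , n<[p+1]u , u-sifted
    where
    u≤n/p : u ≤ n / p
    u≤n/p = s≤s⁻¹ (subst (u <_) (cong suc (m+[n∸m]≡n (/-monoʳ-≤ n (n≤1+n p)))) u<1+n/p)
    pu≤n : p * u ≤ n
    pu≤n = subst (_≤ n) (*-comm u p) (m≤o/n⇒m*n≤o p u≤n/p)
    n<[p+1]u : n < suc p * u
    n<[p+1]u = <-≤-trans (m<[1+m/n]*n n (suc p))
      (subst (suc (n / suc p) * suc p ≤_) (*-comm u (suc p)) (*-monoˡ-≤ (suc p) n/[p+1]<u))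

  ∈-moduli⁺ : ∀ {n p u} → 1 ≤ p → p * u ≤ n → n < suc p * u → Sifted (primesBelow p) u → u ∈ moduli n p
  ∈-moduli⁺ {n} {p@(suc _)} {u} _ pu≤n n<[p+1]u u-sifted =
    ∈-filter⁺ (sifted? (primesBelow p)) (∈-interval⁺ _ _ n/[p+1]<u u<1+n/p) u-sifted
    where
    n/[p+1]<u : suc (n / suc p) ≤ u
    n/[p+1]<u = m<n*o⇒m/o<n (subst (n <_) (*-comm (suc p) u) n<[p+1]u)
    u<1+n/p : u < suc (n / suc p) + (n / p ∸ n / suc p)
    u<1+n/p = s≤s (subst (u ≤_) (sym (m+[n∸m]≡n (/-monoʳ-≤ n (n≤1+n p))))
                         (m*n≤o⇒m≤o/n u (subst (_≤ n) (*-comm p u) pu≤n)))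

  ∈-residues⁺ : ∀ {n p r u} → 1 ≤ p → n ≡ r + p * u → r < u → Sifted (primesBelow p) u → r ∈ residues n p
  ∈-residues⁺ {p = p} {r} {u} 1≤p refl r<u u-sifted =
    subst (_∈ residues (r + p * u) p) (m+n∸n≡m r (p * u))
      (∈-map⁺ _ (∈-moduli⁺ 1≤p (m≤n+m (p * u) r) (+-monoˡ-< (p * u) r<u) u-sifted))

  length-residues : ∀ n p .{{_ : NonZero p}} →
                    length (residues n p) + φ (primesBelow p) (n / suc p) ≡ φ (primesBelow p) (n / p)
  length-residues n p@(suc _) = begin
    length (residues n p) + φ P b                             ≡⟨ cong (_+ φ P b) (length-map _ (moduli n p)) ⟩
    length (filter S (interval (suc b) c)) + φ P b            ≡⟨ +-comm _ (φ P b) ⟩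
    φ P b + length (filter S (interval (suc b) c))            ≡⟨ sym (length-++ (filter S (interval 1 b))) ⟩
    length (filter S (interval 1 b) ++ filter S (interval (suc b) c))
                                                              ≡⟨ cong length (sym (filter-++ S (interval 1 b) _)) ⟩
    length (filter S (interval 1 b ++ interval (suc b) c))    ≡⟨ cong (length ∘ filter S) (sym (interval-++ 1 b c)) ⟩
    φ P (b + c)                                               ≡⟨ cong (φ P) (m+[n∸m]≡n (/-monoʳ-≤ n (n≤1+n p))) ⟩
    φ P (n / p)                                               ∎
    where
    open ≡-Reasoning
    P : List ℕ
    P = primesBelow p
    S : Decidable (Sifted P)
    S = sifted? P
    b c : ℕ
    b = n / suc p
    c = n / p ∸ b

  residue≡mod : ∀ {n p u} .{{_ : NonZero u}} → p * u ≤ n → n < suc p * u → n ∸ p * u ≡ n % u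
  residue≡mod {n} {p} {u} pu≤n n<[p+1]u = begin
    n ∸ p * u                   ≡⟨ sym (m<n⇒m%n≡m r<u) ⟩
    (n ∸ p * u) % u             ≡⟨ sym ([m+kn]%n≡m%n (n ∸ p * u) p u) ⟩
    (n ∸ p * u + p * u) % u     ≡⟨ cong (_% u) (m∸n+n≡m pu≤n) ⟩
    n % u                       ∎
    where
    open ≡-Reasoning
    r<u : n ∸ p * u < u
    r<u = +-cancelʳ-< (p * u) (n ∸ p * u) u (subst (_< u + p * u) (sym (m∸n+n≡m pu≤n)) n<[p+1]u)

  residues⊆remainders : ∀ {n p r} → 2 ≤ p → r ∈ residues n p → r ∈ remainders n
  residues⊆remainders {n} {p} 2≤p r∈ with ∈-map⁻ (λ u → n ∸ p * u) r∈
  ... | u , u∈ , refl with ∈-moduli⁻ n p u∈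
  ... | pu≤n , n<[p+1]u , _ with u
  ...   | zero  = contradiction (subst (n <_) (*-zeroʳ (suc p)) n<[p+1]u) λ ()
  ...   | suc i = subst (_∈ remainders n) (sym (residue≡mod {p = p} pu≤n n<[p+1]u))
                    (∈-map⁺ (λ i → n % suc i) (∈-upTo⁺ (m*n≤o⇒m≤o/n (suc i) 2u≤n)))
    where
    2u≤n : suc i * 2 ≤ n
    2u≤n = ≤-trans (≤-trans (≤-reflexive (*-comm (suc i) 2)) (*-monoˡ-≤ (suc i) 2≤p)) pu≤n

  residues-unique : ∀ n p → Unique (residues n p)
  residues-unique n zero      = []
  residues-unique n p@(suc _) = map-unique injective
    (Unique.filter⁺ (sifted? (primesBelow p)) (interval-unique (suc (n / suc p)) (n / p ∸ n / suc p)))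
    where
    injective : ∀ {u v} → u ∈ moduli n p → v ∈ moduli n p → n ∸ p * u ≡ n ∸ p * v → u ≡ v
    injective {u} {v} u∈ v∈ eq =
      *-cancelˡ-≡ u v p (∸-cancelˡ-≡ (proj₁ (∈-moduli⁻ n p u∈)) (proj₁ (∈-moduli⁻ n p v∈)) eq)

  residues-disjoint : ∀ {n p p′} → Prime p → Prime p′ → p < p′ → Disjoint (residues n p) (residues n p′)
  residues-disjoint {n} {p} {p′} p-prime p′-prime p<p′ (r∈ , r∈′)
    with ∈-map⁻ (λ u → n ∸ p * u) r∈ | ∈-map⁻ (λ u → n ∸ p′ * u) r∈′
  ... | u , u∈ , refl | u′ , u′∈ , r≡ with ∈-moduli⁻ n p u∈ | ∈-moduli⁻ n p′ u′∈
  ... | pu≤n , _ | p′u′≤n , _ , u′-sifted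
    with euclidsLemma p′ u′ p-prime (divides u (trans (sym (∸-cancelˡ-≡ pu≤n p′u′≤n r≡)) (*-comm p u)))
  ... | inj₁ p∣p′ = <⇒≢ p<p′ (prime∣prime⇒≡ p-prime p′-prime p∣p′)
  ... | inj₂ p∣u′ = All.lookup u′-sifted (∈-primesBelow⁺ p-prime p<p′) p∣u′

  residuesUpTo : ℕ → ℕ → List ℕ
  residuesUpTo n y = concatMap (residues n) (primesUpTo y)

  residuesUpTo-unique : ∀ n y → Unique (residuesUpTo n y)
  residuesUpTo-unique n y = concatMap-unique (primesUpTo-unique y) (λ {p} _ → residues-unique n p) disjoint
    where
    disjoint : ∀ {p p′} → p ∈ primesUpTo y → p′ ∈ primesUpTo y → p ≢ p′ →
               Disjoint (residues n p) (residues n p′)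
    disjoint {p} {p′} p∈ p′∈ p≢p′ with <-cmp p p′
    ... | tri< p<p′ _ _ = residues-disjoint (proj₁ (∈-primesUpTo⁻ y p∈)) (proj₁ (∈-primesUpTo⁻ y p′∈)) p<p′
    ... | tri≈ _ p≡p′ _ = contradiction p≡p′ p≢p′
    ... | tri> _ _ p′<p = λ (r∈ , r∈′) →
      residues-disjoint (proj₁ (∈-primesUpTo⁻ y p′∈)) (proj₁ (∈-primesUpTo⁻ y p∈)) p′<p (r∈′ , r∈)

  length-residuesUpTo≤s : ∀ n y → length (residuesUpTo n y) ≤ s n
  length-residuesUpTo≤s n y = unique⊆⇒length≤ (residuesUpTo-unique n y) (∈-deduplicate⁺ _≟_ ∘ ⊆remainders)
    where
    ⊆remainders : ∀ {r} → r ∈ residuesUpTo n y → r ∈ remainders n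
    ⊆remainders r∈ with find (∈-concatMap⁻ (residues n) {xs = primesUpTo y} r∈)
    ... | p , p∈ , r∈′ = residues⊆remainders (prime⇒2≤ (proj₁ (∈-primesUpTo⁻ y p∈))) r∈′

  rough⇒sifted : ∀ {p m u} → p Rough m → u ∣ m → Sifted (primesBelow p) u
  rough⇒sifted {p} p-rough u∣m = All.tabulate λ q∈ q∣u → p-rough
    (hasNonTrivialDivisor {{prime⇒nonTrivial (proj₁ (∈-primesBelow⁻ p q∈))}} (proj₂ (∈-primesBelow⁻ p q∈))
                          (∣-trans q∣u u∣m))

  quotient-decomposition : ∀ {n r} → r ∈ remainders n → ∃[ k ] ∃[ Q ] n ≡ r + Q * k × r < k × 2 ≤ Q
  quotient-decomposition {n} r∈ with ∈-map⁻ (λ i → n % suc i) r∈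
  ... | i , i∈ , refl = suc i , n / suc i , m≡m%n+[m/n]*n n (suc i) , m%n<n n (suc i) ,
    m*n≤o⇒m≤o/n 2 (subst (_≤ n) (*-comm (suc i) 2) (m≤o/n⇒m*n≤o 2 (∈-upTo⁻ i∈)))

  -- with p the least prime factor of Q k, the cofactor u has no prime factor below p,
  -- and p ≤ Q forces r < u
  leastFactor-decomposition : ∀ {n r k Q} → n ≡ r + Q * k → r < k → 2 ≤ Q →
    ∃[ p ] ∃[ u ] Prime p × n ≡ r + p * u × r < u × Sifted (primesBelow p) u
  leastFactor-decomposition {n} {r} {k} {Q} n≡r+Qk r<k 2≤Q
    with leastPrimeFactor (Q * k) (*-mono-≤ 2≤Q (≤-trans (s≤s z≤n) r<k))
  ... | p , p-prime , divides u Qk≡up , p-rough =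
    p , u , p-prime , trans n≡r+Qk (cong (r +_) (sym pu≡Qk)) , r<u ,
    rough⇒sifted p-rough (divides p (trans Qk≡up (*-comm u p)))
    where
    instance
      p≢0 : NonZero p
      p≢0 = prime⇒nonZero p-prime
    pu≡Qk : p * u ≡ Q * k
    pu≡Qk = trans (*-comm p u) (sym Qk≡up)
    r<u : r < u
    r<u = *-cancelˡ-≤ p (≤-trans (*-mono-≤ (rough-∣⇒≤ p-rough 2≤Q (m∣m*n k)) r<k) (≤-reflexive (sym pu≡Qk)))

  remainder-classification : ∀ n y {r} → r ∈ remainders n →
    (∃[ p ] p ∈ primesUpTo y × r ∈ residues n p) ⊎ r < suc n / (2 + y)
  remainder-classification n y {r} r∈ with quotient-decomposition r∈
  ... | k , Q , n≡r+Qk , r<k , 2≤Q with leastFactor-decomposition n≡r+Qk r<k 2≤Q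
  ... | p , u , p-prime , n≡r+pu , r<u , u-sifted with p ≤? y
  ... | yes p≤y = inj₁ (p , ∈-primesUpTo⁺ p-prime p≤y , ∈-residues⁺ (<⇒≤ (prime⇒2≤ p-prime)) n≡r+pu r<u u-sifted)
  ... | no  p≰y = inj₂ (m*n≤o⇒m≤o/n (suc r) (begin
    suc r * (2 + y)     ≤⟨ *-monoʳ-≤ (suc r) (s≤s (≰⇒> p≰y)) ⟩
    suc r * suc p       ≡⟨ *-suc (suc r) p ⟩
    suc r + suc r * p   ≤⟨ +-monoʳ-≤ (suc r) (*-monoˡ-≤ p r<u) ⟩
    suc r + u * p       ≡⟨ cong (λ t → suc (r + t)) (*-comm u p) ⟩
    suc (r + p * u)     ≡⟨ cong suc (sym n≡r+pu) ⟩
    suc n               ∎))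
    where open ≤-Reasoning

  remainders⊆ : ∀ n y {r} → r ∈ remainders n → r ∈ residuesUpTo n y ++ upTo (suc n / (2 + y))
  remainders⊆ n y r∈ = [ (λ (p , p∈ , r∈′) → ∈-++⁺ˡ (∈-concatMap⁺ (residues n) (lose p∈ r∈′)))
                       , (λ r<[n+1]/[y+2] → ∈-++⁺ʳ (residuesUpTo n y) (∈-upTo⁺ r<[n+1]/[y+2])) ]′
                       (remainder-classification n y r∈)

  s≤length-residuesUpTo+[1+n]/[2+y] : ∀ n y → s n ≤ length (residuesUpTo n y) + suc n / (2 + y)
  s≤length-residuesUpTo+[1+n]/[2+y] n y = begin
    s n
      ≤⟨ unique⊆⇒length≤ (deduplicate-! (remainders n)) (remainders⊆ n y ∘ ∈-deduplicate⁻ _≟_ (remainders n)) ⟩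
    length (residuesUpTo n y ++ upTo (suc n / (2 + y)))
      ≡⟨ length-++ (residuesUpTo n y) ⟩
    length (residuesUpTo n y) + length (upTo (suc n / (2 + y)))
      ≡⟨ cong (length (residuesUpTo n y) +_) (length-upTo _) ⟩
    length (residuesUpTo n y) + suc n / (2 + y)
      ∎
    where open ≤-Reasoning

module Density where

  open Rationals
  open Lists
  open Primes
  open Sieve
  open import Data.Nat.Base as ℕ using (ℕ; zero; suc)
  import Data.Nat.Properties as ℕ
  open import Data.Nat.Primality using (prime?)
  open import Data.List.Base using (List; []; _∷_; _++_; filter; foldr)
  open import Data.List.Properties using (foldr-universal)
  open import Data.Product.Base using (proj₁; proj₂)
  open import Data.Rational.Base using (ℚ; 0ℚ; 1ℚ; _+_; _*_; _-_; _≤_)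
  open import Data.Rational.Properties
  open import Data.Rational.Solver using (module +-*-Solver)
  open +-*-Solver using (solve; _:+_; _:-_; _:=_)
  open import Relation.Nullary using (yes; no)
  open import Relation.Unary using (Decidable)
  open import Relation.Binary.PropositionalEquality

  weight : ℕ → ℚ
  weight p = inv (p ℕ.* suc p) * prodBelow p

  weightSum : List ℕ → ℚ
  weightSum = foldr (λ p c → weight p + c) 0ℚ

  -- cPartial and prodBelow fold their lists with local functions that cannot be named here;
  -- foldr-universal identifies them, solved for by unification, with the folds above
  cPartial≡weightSum : ∀ M → cPartial M ≡ weightSum (primesUpTo M)
  cPartial≡weightSum M = universal
    where
    fold : List ℕ → ℚ
    fold = _
    universal : cPartial M ≡ weightSum (primesUpTo M)
    universal with primesUpTo M
    ... | ps = foldr-universal fold (λ p c → weight p + c) 0ℚ refl (λ _ _ → refl) ps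

  prodBelow≡density : ∀ p → prodBelow p ≡ density (primesBelow p)
  prodBelow≡density p = universal
    where
    fold : List ℕ → ℚ
    fold = _
    universal : prodBelow p ≡ density (primesBelow p)
    universal with primesBelow p
    ... | ps = foldr-universal fold (λ q δ → (1ℚ - inv q) * δ) 1ℚ refl (λ _ _ → refl) ps

  weight-nonNeg : ∀ p → 0ℚ ≤ weight p
  weight-nonNeg p = 0≤p∧0≤q⇒0≤p*q (inv-nonNeg (p ℕ.* suc p))
    (subst (0ℚ ≤_) (sym (prodBelow≡density p)) (proj₁ (density-bounds (primesBelow p))))

  weight≤inv : ∀ p → weight p ≤ inv (p ℕ.* suc p)
  weight≤inv p = begin
    inv (p ℕ.* suc p) * prodBelow p   ≤⟨ *-monoˡ-≤-0≤ (inv-nonNeg (p ℕ.* suc p)) prodBelow≤1 ⟩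
    inv (p ℕ.* suc p) * 1ℚ            ≡⟨ *-identityʳ _ ⟩
    inv (p ℕ.* suc p)                 ∎
    where
    open ≤-Reasoning
    prodBelow≤1 : prodBelow p ≤ 1ℚ
    prodBelow≤1 = subst (_≤ 1ℚ) (sym (prodBelow≡density p)) (proj₂ (density-bounds (primesBelow p)))

  weightSum-++ : ∀ xs ys → weightSum (xs ++ ys) ≡ weightSum xs + weightSum ys
  weightSum-++ []       ys = sym (+-identityˡ (weightSum ys))
  weightSum-++ (x ∷ xs) ys =
    trans (cong (weight x +_) (weightSum-++ xs ys)) (sym (+-assoc (weight x) (weightSum xs) (weightSum ys)))

  weightSum-nonNeg : ∀ xs → 0ℚ ≤ weightSum xs
  weightSum-nonNeg []       = ≤-refl
  weightSum-nonNeg (x ∷ xs) = +-mono-≤ (weight-nonNeg x) (weightSum-nonNeg xs)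

  -- telescopes, since weight q ≤ 1/q - 1/(q + 1)
  weightSum-interval : ∀ {P : ℕ → Set} (P? : Decidable P) a k →
                       weightSum (filter P? (interval (suc a) k)) ≤ inv (suc a)
  weightSum-interval P? a zero    = inv-nonNeg (suc a)
  weightSum-interval P? a (suc k) with P? (suc a)
  ... | no  _ = ≤-trans (weightSum-interval P? (suc a) k) (inv-suc≤inv (suc a))
  ... | yes _ = begin
    weight (suc a) + weightSum (filter P? (interval (suc (suc a)) k))
      ≤⟨ +-mono-≤ (weight≤inv (suc a)) (weightSum-interval P? (suc a) k) ⟩
    inv (suc a ℕ.* suc (suc a)) + inv (suc (suc a))
      ≡⟨ cong (_+ inv (suc (suc a))) (inv-*-suc (suc a)) ⟩
    (inv (suc a) - inv (suc (suc a))) + inv (suc (suc a))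
      ≡⟨ cancel (inv (suc a)) (inv (suc (suc a))) ⟩
    inv (suc a)
      ∎
    where
    open ≤-Reasoning
    cancel : ∀ x y → (x - y) + y ≡ x
    cancel = solve 2 (λ x y → (x :- y) :+ y := x) refl

  cPartial-+ : ∀ a k → cPartial (a ℕ.+ k) ≡ cPartial a + weightSum (filter prime? (interval (suc a) k))
  cPartial-+ a k = begin
    cPartial (a ℕ.+ k)                                ≡⟨ cPartial≡weightSum (a ℕ.+ k) ⟩
    weightSum (primesUpTo (a ℕ.+ k))                  ≡⟨ cong weightSum (primesUpTo-+ a k) ⟩
    weightSum (primesUpTo a ++ tail)                  ≡⟨ weightSum-++ (primesUpTo a) tail ⟩
    weightSum (primesUpTo a) + weightSum tail         ≡⟨ cong (_+ weightSum tail) (sym (cPartial≡weightSum a)) ⟩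
    cPartial a + weightSum tail                       ∎
    where
    open ≡-Reasoning
    tail : List ℕ
    tail = filter prime? (interval (suc a) k)

  cPartial-mono-≤ : ∀ {M N} → M ℕ.≤ N → cPartial M ≤ cPartial N
  cPartial-mono-≤ {M} {N} M≤N = begin
    cPartial M                                    ≤⟨ p≤p+q (weightSum-nonNeg tail) ⟩
    cPartial M + weightSum tail                   ≡⟨ sym (cPartial-+ M (N ℕ.∸ M)) ⟩
    cPartial (M ℕ.+ (N ℕ.∸ M))                    ≡⟨ cong cPartial (ℕ.m+[n∸m]≡n M≤N) ⟩
    cPartial N                                    ∎
    where
    open ≤-Reasoning
    tail : List ℕ
    tail = filter prime? (interval (suc M) (N ℕ.∸ M))

  cPartial≤cPartial+inv : ∀ M y → cPartial M ≤ cPartial y + inv (suc y)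
  cPartial≤cPartial+inv M y = begin
    cPartial M                                    ≤⟨ cPartial-mono-≤ (ℕ.m≤n+m∸n M y) ⟩
    cPartial (y ℕ.+ (M ℕ.∸ y))                    ≡⟨ cPartial-+ y (M ℕ.∸ y) ⟩
    cPartial y + weightSum tail                   ≤⟨ +-monoʳ-≤ (cPartial y) (weightSum-interval prime? y (M ℕ.∸ y)) ⟩
    cPartial y + inv (suc y)                      ∎
    where
    open ≤-Reasoning
    tail : List ℕ
    tail = filter prime? (interval (suc y) (M ℕ.∸ y))

module Estimates where

  open Rationals
  open Primes
  open Sieve
  open Remainders
  open Density
  open import Data.Nat.Base as ℕ using (ℕ; suc; _^_; NonZero; s≤s)
  import Data.Nat.Properties as ℕ
  open import Data.Nat.DivMod using (_/_)
  open import Data.Nat.Primality using (Prime; prime⇒nonZero)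
  open import Data.List.Base using (List; []; _∷_; _++_; length; concatMap)
  open import Data.List.Properties using (length-++)
  open import Data.List.Membership.Propositional using (_∈_)
  open import Data.List.Relation.Unary.All using (All)
  open import Data.List.Relation.Unary.Unique.Propositional using (Unique)
  open import Data.List.Relation.Unary.Any using (here; there)
  open import Data.Product.Base using (_×_; proj₁; proj₂)
  open import Data.Rational.Base using (ℚ; 0ℚ; 1ℚ; _+_; _*_; _-_; -_; _≤_; ∣_∣)
  open import Data.Rational.Properties
  open import Data.Rational.Solver using (module +-*-Solver)
  open +-*-Solver using (solve; _:+_; _:*_; _:-_; :-_; con; _:=_)
  open import Function.Base using (_∘_)
  open import Relation.Binary.PropositionalEquality

  -- #residues = φ(n / p) - φ(n / (p + 1)) and n · weight p = (n / p - n / (p + 1)) · δ: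
  -- compare both φ's with Legendre's estimate and both quotients with their floors
  residues-estimate : ∀ n p → Prime p →
    ∣ toℚ (length (residues n p)) - toℚ n * weight p ∣ ≤ toℚ (2 ^ suc (length (primesBelow p)))
  residues-estimate n p p-prime = begin
    ∣ A - N * weight p ∣
      ≡⟨ cong ∣_∣ decomposition ⟩
    ∣ (Φ₁ - X₁ * δ) - (Φ₀ - X₀ * δ) + (e₀ * δ - e₁ * δ) ∣
      ≤⟨ ∣p-q+r∣≤∣p∣+∣q∣+∣r∣ (Φ₁ - X₁ * δ) (Φ₀ - X₀ * δ) (e₀ * δ - e₁ * δ) ⟩
    ∣ Φ₁ - X₁ * δ ∣ + ∣ Φ₀ - X₀ * δ ∣ + ∣ e₀ * δ - e₁ * δ ∣
      ≤⟨ +-mono-≤ (+-mono-≤ (legendre P P-primes !P (n / p)) (legendre P P-primes !P (n / suc p)))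
                  (≤-trans (∣p-q∣≤∣p∣+∣q∣ (e₀ * δ) (e₁ * δ))
                           (+-mono-≤ (rounding-error n (suc p) P) (rounding-error n p P))) ⟩
    (E - 1ℚ) + (E - 1ℚ) + (1ℚ + 1ℚ)
      ≡⟨ double E ⟩
    (1ℚ + 1ℚ) * E
      ≡⟨ sym (toℚ-* 2 (2 ^ length P)) ⟩
    toℚ (2 ^ suc (length P))
      ∎
    where
    open ≤-Reasoning
    instance
      p≢0 : NonZero p
      p≢0 = prime⇒nonZero p-prime
    P : List ℕ
    P = primesBelow p
    P-primes : All Prime P
    P-primes = primesBelow-primes p
    !P : Unique P
    !P = primesBelow-unique p
    A N X₁ X₀ Φ₁ Φ₀ δ E e₁ e₀ : ℚ
    A  = toℚ (length (residues n p))
    N  = toℚ n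
    X₁ = toℚ (n / p)
    X₀ = toℚ (n / suc p)
    Φ₁ = toℚ (φ P (n / p))
    Φ₀ = toℚ (φ P (n / suc p))
    δ  = density P
    E  = toℚ (2 ^ length P)
    e₁ = N * inv p - X₁
    e₀ = N * inv (suc p) - X₀
    A+Φ₀≡Φ₁ : A + Φ₀ ≡ Φ₁
    A+Φ₀≡Φ₁ = trans (sym (toℚ-+ (length (residues n p)) (φ P (n / suc p)))) (cong toℚ (length-residues n p))
    rearrange : ∀ A Φ₀ N X₁ X₀ i j δ → A - N * ((i - j) * δ) ≡
                ((A + Φ₀) - X₁ * δ) - (Φ₀ - X₀ * δ) + ((N * j - X₀) * δ - (N * i - X₁) * δ)
    rearrange = solve 8 (λ A Φ₀ N X₁ X₀ i j δ → A :- N :* ((i :- j) :* δ) :=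
      ((A :+ Φ₀) :- X₁ :* δ) :- (Φ₀ :- X₀ :* δ) :+ ((N :* j :- X₀) :* δ :- (N :* i :- X₁) :* δ)) refl
    decomposition : A - N * weight p ≡ (Φ₁ - X₁ * δ) - (Φ₀ - X₀ * δ) + (e₀ * δ - e₁ * δ)
    decomposition = begin-equality
      A - N * weight p
        ≡⟨ cong (λ w → A - N * w) (cong₂ _*_ (inv-*-suc p) (prodBelow≡density p)) ⟩
      A - N * ((inv p - inv (suc p)) * δ)
        ≡⟨ rearrange A Φ₀ N X₁ X₀ (inv p) (inv (suc p)) δ ⟩
      ((A + Φ₀) - X₁ * δ) - (Φ₀ - X₀ * δ) + (e₀ * δ - e₁ * δ)
        ≡⟨ cong (λ t → (t - X₁ * δ) - (Φ₀ - X₀ * δ) + (e₀ * δ - e₁ * δ)) A+Φ₀≡Φ₁ ⟩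
      (Φ₁ - X₁ * δ) - (Φ₀ - X₀ * δ) + (e₀ * δ - e₁ * δ)
        ∎
    double : ∀ E → (E - 1ℚ) + (E - 1ℚ) + (1ℚ + 1ℚ) ≡ (1ℚ + 1ℚ) * E
    double = solve 1 (λ E → (E :- con 1ℚ) :+ (E :- con 1ℚ) :+ (con 1ℚ :+ con 1ℚ) := (con 1ℚ :+ con 1ℚ) :* E) refl

  errorTerm : ℕ → ℕ
  errorTerm y = π y ℕ.* 2 ^ suc (π y)

  concatMap-residues-estimate : ∀ n y ps → (∀ {p} → p ∈ ps → Prime p × p ℕ.≤ y) →
    ∣ toℚ (length (concatMap (residues n) ps)) - toℚ n * weightSum ps ∣ ≤ toℚ (length ps ℕ.* 2 ^ suc (π y))
  concatMap-residues-estimate n y []       _     = ≤-reflexive (cong ∣_∣ (cancel (toℚ n)))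
    where
    cancel : ∀ N → 0ℚ - N * 0ℚ ≡ 0ℚ
    cancel = solve 1 (λ N → con 0ℚ :- N :* con 0ℚ := con 0ℚ) refl
  concatMap-residues-estimate n y (p ∷ ps) ps≤y = begin
    ∣ toℚ (length (residues n p ++ concatMap (residues n) ps)) - N * (weight p + W) ∣
      ≡⟨ cong (λ t → ∣ t - N * (weight p + W) ∣) length-concat ⟩
    ∣ (A + R) - N * (weight p + W) ∣
      ≡⟨ cong ∣_∣ (regroup A R N (weight p) W) ⟩
    ∣ (A - N * weight p) + (R - N * W) ∣
      ≤⟨ ∣p+q∣≤∣p∣+∣q∣ (A - N * weight p) (R - N * W) ⟩
    ∣ A - N * weight p ∣ + ∣ R - N * W ∣
      ≤⟨ +-mono-≤ (≤-trans (residues-estimate n p p-prime) (toℚ-mono-≤ 2^[1+P]≤E))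
                  (concatMap-residues-estimate n y ps (ps≤y ∘ there)) ⟩
    toℚ E + toℚ (length ps ℕ.* E)
      ≡⟨ sym (toℚ-+ E (length ps ℕ.* E)) ⟩
    toℚ (length (p ∷ ps) ℕ.* E)
      ∎
    where
    open ≤-Reasoning
    p-prime : Prime p
    p-prime = proj₁ (ps≤y (here refl))
    N W A R : ℚ
    N = toℚ n
    W = weightSum ps
    A = toℚ (length (residues n p))
    R = toℚ (length (concatMap (residues n) ps))
    E : ℕ
    E = 2 ^ suc (π y)
    length-concat : toℚ (length (residues n p ++ concatMap (residues n) ps)) ≡ A + R
    length-concat = trans (cong toℚ (length-++ (residues n p))) (toℚ-+ (length (residues n p)) _)
    regroup : ∀ A R N w W → (A + R) - N * (w + W) ≡ (A - N * w) + (R - N * W)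
    regroup = solve 5 (λ A R N w W → (A :+ R) :- N :* (w :+ W) := (A :- N :* w) :+ (R :- N :* W)) refl
    2^[1+P]≤E : 2 ^ suc (length (primesBelow p)) ℕ.≤ E
    2^[1+P]≤E = ℕ.^-monoʳ-≤ 2 (s≤s (ℕ.≤-trans (length-primesBelow≤π p) (π-mono-≤ (proj₂ (ps≤y (here refl))))))

  residuesUpTo-estimate : ∀ n y → ∣ toℚ (length (residuesUpTo n y)) - toℚ n * cPartial y ∣ ≤ toℚ (errorTerm y)
  residuesUpTo-estimate n y = subst (λ c → ∣ toℚ (length (residuesUpTo n y)) - toℚ n * c ∣ ≤ toℚ (errorTerm y))
    (sym (cPartial≡weightSum y)) (concatMap-residues-estimate n y (primesUpTo y) (∈-primesUpTo⁻ y))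

  cPartial*n-s≤ : ∀ n y M → cPartial M * toℚ n - toℚ (s n) ≤ toℚ (errorTerm y) + toℚ n * inv (suc y)
  cPartial*n-s≤ n y M = begin
    cPartial M * N - toℚ (s n)          ≤⟨ +-mono-≤ (*-monoʳ-≤-0≤ (toℚ-nonNeg n) (cPartial≤cPartial+inv M y))
                                                    (neg-antimono-≤ (toℚ-mono-≤ (length-residuesUpTo≤s n y))) ⟩
    (c + inv (suc y)) * N - A           ≡⟨ regroup A N c (inv (suc y)) ⟩
    - (A - N * c) + N * inv (suc y)     ≤⟨ +-monoˡ-≤ (N * inv (suc y)) (-p≤∣p∣ (A - N * c)) ⟩
    ∣ A - N * c ∣ + N * inv (suc y)     ≤⟨ +-monoˡ-≤ (N * inv (suc y)) (residuesUpTo-estimate n y) ⟩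
    toℚ (errorTerm y) + N * inv (suc y) ∎
    where
    open ≤-Reasoning
    N A c : ℚ
    N = toℚ n
    A = toℚ (length (residuesUpTo n y))
    c = cPartial y
    regroup : ∀ A N c i → (c + i) * N - A ≡ - (A - N * c) + N * i
    regroup = solve 4 (λ A N c i → (c :+ i) :* N :- A := :- (A :- N :* c) :+ N :* i) refl

  s-cPartial*n≤ : ∀ n y → toℚ (s n) - cPartial y * toℚ n ≤ toℚ (errorTerm y) + toℚ (suc n / (2 ℕ.+ y))
  s-cPartial*n≤ n y = begin
    toℚ (s n) - c * N                   ≤⟨ +-monoˡ-≤ (- (c * N))
                                             (toℚ-mono-≤ (s≤length-residuesUpTo+[1+n]/[2+y] n y)) ⟩
    toℚ (a ℕ.+ b) - c * N               ≡⟨ cong (_- c * N) (toℚ-+ a b) ⟩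
    (A + B) - c * N                     ≡⟨ regroup A B N c ⟩
    (A - N * c) + B                     ≤⟨ +-monoˡ-≤ B (p≤∣p∣ (A - N * c)) ⟩
    ∣ A - N * c ∣ + B                   ≤⟨ +-monoˡ-≤ B (residuesUpTo-estimate n y) ⟩
    toℚ (errorTerm y) + B               ∎
    where
    open ≤-Reasoning
    a b : ℕ
    a = length (residuesUpTo n y)
    b = suc n / (2 ℕ.+ y)
    N c A B : ℚ
    N = toℚ n
    c = cPartial y
    A = toℚ a
    B = toℚ b
    regroup : ∀ A B N c → (A + B) - c * N ≡ (A - N * c) + B
    regroup = solve 4 (λ A B N c → (A :+ B) :- c :* N := (A :- N :* c) :+ B) refl

module Chebyshev where

  open Lists
  open Primes
  open import Data.Nat.Base
    using (ℕ; zero; suc; _+_; _*_; _∸_; _^_; _≤_; _<_; _!; NonZero; z≤n; s≤s; s≤s⁻¹; ≢-nonZero; ≢-nonZero⁻¹)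
  open import Data.Nat.Properties
  open import Data.Nat.DivMod using (_/_; m/n*n≡m)
  open import Data.Nat.Divisibility using (_∣_; divides; ∣-trans; ∣⇒≤; ∣1⇒≡1; m∣m*n; m≤n⇒m!∣n!)
  open import Data.Nat.Combinatorics using (_C_; nCk+nC[k+1]≡[n+1]C[k+1]; nCk≡n!/k![n-k]!; k![n∸k]!∣n!)
  open import Data.Nat.ListAction using (product)
  open import Data.Nat.Primality using (Prime; prime?; euclidsLemma; prime⇒nonZero; ¬prime[1])
  open import Data.List.Base using (List; []; _∷_; length; filter; upTo)
  open import Data.List.Properties using (length-++; length-filter; length-upTo)
  open import Data.List.Membership.Propositional using (_∈_)
  open import Data.List.Membership.Propositional.Properties using (∈-filter⁻)
  open import Data.List.Relation.Unary.Any using (here; there)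
  open import Data.List.Relation.Unary.All as All using (All; []; _∷_)
  open import Data.List.Relation.Unary.Unique.Propositional using (Unique; []; _∷_)
  import Data.List.Relation.Unary.Unique.Propositional.Properties as Unique
  open import Data.Product.Base using (_×_; _,_; proj₁; proj₂)
  open import Data.Sum.Base using (inj₁; inj₂; [_,_]′)
  open import Function.Base using (_∘_; id)
  open import Relation.Nullary using (yes; no; contradiction)
  open import Relation.Binary.PropositionalEquality

  nCk≤2^n : ∀ n k → n C k ≤ 2 ^ n
  nCk≤2^n zero    zero    = ≤-refl
  nCk≤2^n zero    (suc k) = z≤n
  nCk≤2^n (suc n) zero    = m^n>0 2 (suc n)
  nCk≤2^n (suc n) (suc k) = begin
    suc n C suc k         ≡⟨ sym (nCk+nC[k+1]≡[n+1]C[k+1] n k) ⟩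
    n C k + n C suc k     ≤⟨ +-mono-≤ (nCk≤2^n n k) (nCk≤2^n n (suc k)) ⟩
    2 ^ n + 2 ^ n         ≡⟨ cong (2 ^ n +_) (sym (+-identityʳ (2 ^ n))) ⟩
    2 ^ suc n             ∎
    where open ≤-Reasoning

  [m+m]!≡[m+m]Cm*m!*m! : ∀ m → (m + m) ! ≡ ((m + m) C m) * (m ! * m !)
  [m+m]!≡[m+m]Cm*m!*m! m = begin
    (m + m) !                                ≡⟨ sym (m/n*n≡m m!m!∣[m+m]!) ⟩
    (m + m) ! / (m ! * m !) * (m ! * m !)    ≡⟨ cong (_* (m ! * m !)) (sym [m+m]Cm≡) ⟩
    ((m + m) C m) * (m ! * m !)              ∎
    where
    open ≡-Reasoning
    instance
      m!m!≢0 : NonZero (m ! * m !)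
      m!m!≢0 = m*n≢0 (m !) (m !) {{m !≢0}} {{m !≢0}}
    m+m∸m≡m : m + m ∸ m ≡ m
    m+m∸m≡m = m+n∸m≡n m m
    m!m!∣[m+m]! : m ! * m ! ∣ (m + m) !
    m!m!∣[m+m]! = subst (λ k → m ! * k ! ∣ (m + m) !) m+m∸m≡m (k![n∸k]!∣n! (m≤m+n m m))
    [m+m]Cm≡ : (m + m) C m ≡ (m + m) ! / (m ! * m !)
    [m+m]Cm≡ rewrite nCk≡n!/k![n-k]! {m + m} {m} (m≤m+n m m) | m+m∸m≡m = refl

  n∣n! : ∀ n .{{_ : NonZero n}} → n ∣ n !
  n∣n! (suc n) = m∣m*n (n !)

  prime∣n!⇒≤ : ∀ {p} n → Prime p → p ∣ n ! → p ≤ n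
  prime∣n!⇒≤ zero    p-prime p∣1 = contradiction (subst Prime (∣1⇒≡1 p∣1) p-prime) ¬prime[1]
  prime∣n!⇒≤ (suc n) p-prime p∣[1+n]! with euclidsLemma (suc n) (n !) p-prime p∣[1+n]!
  ... | inj₁ p∣1+n = ∣⇒≤ p∣1+n
  ... | inj₂ p∣n!  = m≤n⇒m≤1+n (prime∣n!⇒≤ n p-prime p∣n!)

  prime∣centralBinomial : ∀ {m p} → Prime p → m < p → p ≤ m + m → p ∣ (m + m) C m
  prime∣centralBinomial {m} {p} p-prime m<p p≤2m with euclidsLemma ((m + m) C m) (m ! * m !) p-prime
    (subst (p ∣_) ([m+m]!≡[m+m]Cm*m!*m! m) (∣-trans (n∣n! p {{prime⇒nonZero p-prime}}) (m≤n⇒m!∣n! p≤2m)))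
  ... | inj₁ p∣C     = p∣C
  ... | inj₂ p∣m!m! = contradiction
    (prime∣n!⇒≤ m p-prime ([ id , id ]′ (euclidsLemma (m !) (m !) p-prime p∣m!m!))) (<⇒≱ m<p)

  prime∣product⇒∈ : ∀ {q ps} → Prime q → All Prime ps → q ∣ product ps → q ∈ ps
  prime∣product⇒∈ {ps = []}     q-prime _ q∣1 = contradiction (subst Prime (∣1⇒≡1 q∣1) q-prime) ¬prime[1]
  prime∣product⇒∈ {ps = p ∷ ps} q-prime (p-prime ∷ ps-prime) q∣pΠ with euclidsLemma p (product ps) q-prime q∣pΠ
  ... | inj₁ q∣p = here (prime∣prime⇒≡ q-prime p-prime q∣p)
  ... | inj₂ q∣Π = there (prime∣product⇒∈ q-prime ps-prime q∣Π)

  product∣ : ∀ {N ps} → Unique ps → All Prime ps → All (_∣ N) ps → product ps ∣ N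
  product∣ {N} {[]}     _            _                    _            = divides N (sym (*-identityʳ N))
  product∣ {N} {p ∷ ps} (p∉ps ∷ !ps) (p-prime ∷ ps-prime) (p∣N ∷ ps∣N) with product∣ !ps ps-prime ps∣N
  ... | divides t N≡tΠ with euclidsLemma t (product ps) p-prime (subst (p ∣_) N≡tΠ p∣N)
  ...   | inj₁ (divides u t≡up) =
    divides u (trans N≡tΠ (trans (cong (_* product ps) t≡up) (*-assoc u p (product ps))))
  ...   | inj₂ p∣Π = contradiction refl (All.lookup p∉ps (prime∣product⇒∈ p-prime ps-prime p∣Π))

  ^-length≤product : ∀ m ps → All (m ≤_) ps → m ^ length ps ≤ product ps
  ^-length≤product m []       []           = ≤-refl
  ^-length≤product m (p ∷ ps) (m≤p ∷ m≤ps) = *-mono-≤ m≤p (^-length≤product m ps m≤ps)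

  primesBetween : ℕ → List ℕ
  primesBetween m = filter prime? (interval (suc m) m)

  -- every prime in (m, 2m] divides the central binomial coefficient, which is at most 4^m
  ^-primesBetween≤4^m : ∀ m → m ^ length (primesBetween m) ≤ 2 ^ (m + m)
  ^-primesBetween≤4^m m = begin
    m ^ length (primesBetween m)
      ≤⟨ ^-length≤product m (primesBetween m) (All.tabulate (<⇒≤ ∘ proj₁ ∘ bounds)) ⟩
    product (primesBetween m)
      ≤⟨ ∣⇒≤ {{C≢0}} (product∣ !ps ps-prime (All.tabulate λ p∈ →
           prime∣centralBinomial (prime p∈) (proj₁ (bounds p∈)) (proj₂ (bounds p∈)))) ⟩
    (m + m) C m
      ≤⟨ nCk≤2^n (m + m) m ⟩
    2 ^ (m + m)
      ∎
    where
    open ≤-Reasoning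
    prime : ∀ {p} → p ∈ primesBetween m → Prime p
    prime p∈ = proj₂ (∈-filter⁻ prime? {xs = interval (suc m) m} p∈)
    bounds : ∀ {p} → p ∈ primesBetween m → m < p × p ≤ m + m
    bounds p∈ with ∈-interval⁻ (suc m) m (proj₁ (∈-filter⁻ prime? {xs = interval (suc m) m} p∈))
    ... | m<p , p<1+2m = m<p , s≤s⁻¹ p<1+2m
    ps-prime : All Prime (primesBetween m)
    ps-prime = All.tabulate prime
    !ps : Unique (primesBetween m)
    !ps = Unique.filter⁺ prime? (interval-unique (suc m) m)
    C≢0 : NonZero ((m + m) C m)
    C≢0 = ≢-nonZero λ C≡0 → ≢-nonZero⁻¹ ((m + m) !) {{(m + m) !≢0}}
            (trans ([m+m]!≡[m+m]Cm*m!*m! m) (cong (_* (m ! * m !)) C≡0))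

  2^-cancel-≤ : ∀ {a b} → 2 ^ a ≤ 2 ^ b → a ≤ b
  2^-cancel-≤ {a} {b} 2^a≤2^b with b <? a
  ... | yes b<a = contradiction 2^a≤2^b (<⇒≱ (^-monoʳ-< 2 (s≤s (s≤s z≤n)) b<a))
  ... | no  b≮a = ≮⇒≥ b≮a

  2^suc≡2^+2^ : ∀ a → 2 ^ suc a ≡ 2 ^ a + 2 ^ a
  2^suc≡2^+2^ a = cong (2 ^ a +_) (+-identityʳ (2 ^ a))

  j*primesBetween2^j≤2^[1+j] : ∀ j → j * length (primesBetween (2 ^ j)) ≤ 2 ^ suc j
  j*primesBetween2^j≤2^[1+j] j = 2^-cancel-≤ (begin
    2 ^ (j * length (primesBetween (2 ^ j)))   ≡⟨ sym (^-*-assoc 2 j _) ⟩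
    (2 ^ j) ^ length (primesBetween (2 ^ j))   ≤⟨ ^-primesBetween≤4^m (2 ^ j) ⟩
    2 ^ (2 ^ j + 2 ^ j)                         ≡⟨ cong (2 ^_) (sym (2^suc≡2^+2^ j)) ⟩
    2 ^ 2 ^ suc j                               ∎)
    where open ≤-Reasoning

  π-2^suc : ∀ j → π (2 ^ suc j) ≡ π (2 ^ j) + length (primesBetween (2 ^ j))
  π-2^suc j = trans (cong π (2^suc≡2^+2^ j))
    (trans (cong length (primesUpTo-+ (2 ^ j) (2 ^ j))) (length-++ (primesUpTo (2 ^ j))))

  π≤1+ : ∀ x → π x ≤ suc x
  π≤1+ x = subst (π x ≤_) (length-upTo (suc x)) (length-filter prime? (upTo (suc x)))

  -- sums j · #(primes in (2^j, 2^(j+1)]) ≤ 2^(j+1) over h ≤ j < h + d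
  chebyshev-from : ∀ h d → h * π (2 ^ (h + d)) ≤ h * π (2 ^ h) + 2 ^ suc (h + d)
  chebyshev-from h zero    = subst (λ a → h * π (2 ^ a) ≤ h * π (2 ^ h) + 2 ^ suc a) (sym (+-identityʳ h))
                                   (m≤m+n (h * π (2 ^ h)) _)
  chebyshev-from h (suc d) = begin
    h * π (2 ^ (h + suc d))                                ≡⟨ cong (λ a → h * π (2 ^ a)) (+-suc h d) ⟩
    h * π (2 ^ suc (h + d))                                ≡⟨ cong (h *_) (π-2^suc (h + d)) ⟩
    h * (π (2 ^ (h + d)) + r)                              ≡⟨ *-distribˡ-+ h (π (2 ^ (h + d))) r ⟩
    h * π (2 ^ (h + d)) + h * r                            ≤⟨ +-mono-≤ (chebyshev-from h d) h*r≤ ⟩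
    h * π (2 ^ h) + 2 ^ suc (h + d) + 2 ^ suc (h + d)      ≡⟨ +-assoc (h * π (2 ^ h)) _ _ ⟩
    h * π (2 ^ h) + (2 ^ suc (h + d) + 2 ^ suc (h + d))    ≡⟨ cong (h * π (2 ^ h) +_) (sym (2^suc≡2^+2^ (suc (h + d)))) ⟩
    h * π (2 ^ h) + 2 ^ suc (suc (h + d))                  ≡⟨ cong (λ a → h * π (2 ^ h) + 2 ^ suc a) (sym (+-suc h d)) ⟩
    h * π (2 ^ h) + 2 ^ suc (h + suc d)                    ∎
    where
    open ≤-Reasoning
    r : ℕ
    r = length (primesBetween (2 ^ (h + d)))
    h*r≤ : h * r ≤ 2 ^ suc (h + d)
    h*r≤ = ≤-trans (*-monoˡ-≤ r (m≤m+n h d)) (j*primesBetween2^j≤2^[1+j] (h + d))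

  chebyshev : ∀ h a → h ≤ a → h * π (2 ^ a) ≤ h * suc (2 ^ h) + 2 ^ suc a
  chebyshev h a h≤a = begin
    h * π (2 ^ a)                          ≡⟨ cong (λ b → h * π (2 ^ b)) (sym (m+[n∸m]≡n h≤a)) ⟩
    h * π (2 ^ (h + (a ∸ h)))              ≤⟨ chebyshev-from h (a ∸ h) ⟩
    h * π (2 ^ h) + 2 ^ suc (h + (a ∸ h))  ≡⟨ cong (λ b → h * π (2 ^ h) + 2 ^ suc b) (m+[n∸m]≡n h≤a) ⟩
    h * π (2 ^ h) + 2 ^ suc a              ≤⟨ +-monoˡ-≤ (2 ^ suc a) (*-monoʳ-≤ h (π≤1+ (2 ^ h))) ⟩
    h * suc (2 ^ h) + 2 ^ suc a            ∎
    where open ≤-Reasoning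

module Logarithms where

  open import Data.Nat.Base using (zero; suc; _+_; _*_; _^_; _≤_; _<_; ⌊_/2⌋; ⌈_/2⌉; z≤n; s≤s)
  open import Data.Nat.Properties
  open import Data.Nat.Logarithm using (⌊log₂_⌋; ⌊log₂⌋-mono-≤; ⌊log₂[2^n]⌋≡n)
  open import Data.Nat.Logarithm.Core using (⌊log2⌋)
  open import Function.Base using (_∘_)
  open import Induction.WellFounded using (Acc; acc)
  open import Relation.Nullary using (yes; no; contradiction)
  open import Relation.Binary.PropositionalEquality

  2^⌊log2⌋≤n : ∀ n (rec : Acc _<_ n) → 1 ≤ n → 2 ^ ⌊log2⌋ n rec ≤ n
  2^⌊log2⌋≤n (suc zero)    _        _ = ≤-refl
  2^⌊log2⌋≤n (suc (suc n)) (acc rs) _ = begin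
    2 * 2 ^ ⌊log2⌋ (suc ⌊ n /2⌋) _   ≤⟨ *-monoʳ-≤ 2 (2^⌊log2⌋≤n (suc ⌊ n /2⌋) _ (s≤s z≤n)) ⟩
    2 * suc ⌊ n /2⌋                  ≡⟨ cong suc (trans (cong (⌊ n /2⌋ +_) (*-identityˡ (suc ⌊ n /2⌋)))
                                                        (+-suc ⌊ n /2⌋ ⌊ n /2⌋)) ⟩
    suc (suc (⌊ n /2⌋ + ⌊ n /2⌋))    ≤⟨ s≤s (s≤s (+-monoʳ-≤ ⌊ n /2⌋ (⌊n/2⌋≤⌈n/2⌉ n))) ⟩
    suc (suc (⌊ n /2⌋ + ⌈ n /2⌉))    ≡⟨ cong (suc ∘ suc) (⌊n/2⌋+⌈n/2⌉≡n n) ⟩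
    suc (suc n)                      ∎
    where open ≤-Reasoning

  2^⌊log₂n⌋≤n : ∀ {n} → 1 ≤ n → 2 ^ ⌊log₂ n ⌋ ≤ n
  2^⌊log₂n⌋≤n {n} = 2^⌊log2⌋≤n n _

  2^j≤n⇒j≤⌊log₂n⌋ : ∀ {j n} → 2 ^ j ≤ n → j ≤ ⌊log₂ n ⌋
  2^j≤n⇒j≤⌊log₂n⌋ {j} 2^j≤n = subst (_≤ _) (⌊log₂[2^n]⌋≡n j) (⌊log₂⌋-mono-≤ 2^j≤n)

  n<2^[1+⌊log₂n⌋] : ∀ n → n < 2 ^ suc ⌊log₂ n ⌋
  n<2^[1+⌊log₂n⌋] n with n <? 2 ^ suc ⌊log₂ n ⌋
  ... | yes n<2^[1+k] = n<2^[1+k]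
  ... | no  n≮2^[1+k] = contradiction (2^j≤n⇒j≤⌊log₂n⌋ (≮⇒≥ n≮2^[1+k])) 1+n≰n

  n<2^n : ∀ n → n < 2 ^ n
  n<2^n zero    = s≤s z≤n
  n<2^n (suc n) = begin
    suc (suc n)     ≤⟨ +-mono-≤ (m^n>0 2 n) (n<2^n n) ⟩
    2 ^ n + 2 ^ n   ≡⟨ cong (2 ^ n +_) (sym (+-identityʳ (2 ^ n))) ⟩
    2 ^ suc n       ∎
    where open ≤-Reasoning

module Parameters where

  open Primes using (π)
  open Chebyshev using (chebyshev)
  open Estimates using (errorTerm)
  open Logarithms
  open import Data.Nat.Base using (ℕ; zero; suc; _+_; _*_; _∸_; _^_; _≤_; _<_; z≤n; s≤s; >-nonZero)
  open import Data.Nat.Properties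
  open import Data.Nat.DivMod using (_/_; m/n*n≤m)
  open import Data.Nat.Logarithm using (⌊log₂_⌋)
  open import Data.Nat.Tactic.RingSolver using (solve-∀)
  open import Relation.Binary.PropositionalEquality

  -- y ≈ L(n) / 64: large enough for the tail 1/y of the series, small enough that
  -- Chebyshev's bound keeps 2^π(y) far below n
  sieveLimit : ℕ → ℕ
  sieveLimit n = 2 ^ (⌊log₂ ⌊log₂ n ⌋ ⌋ ∸ 6 + ⌊log₂ ⌊log₂ ⌊log₂ n ⌋ ⌋ ⌋)

  -- makes ⌊log₂ ⌊log₂ n⌋⌋ ≥ 12
  threshold : ℕ
  threshold = 2 ^ 2 ^ 12

  192ℓ+320≤59*2^ℓ : ∀ d → 192 * (6 + d) + 320 ≤ 59 * 2 ^ (6 + d)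
  192ℓ+320≤59*2^ℓ zero    = m≤m+n 1472 2304
  192ℓ+320≤59*2^ℓ (suc d) = begin
    192 * (6 + suc d) + 320                 ≡⟨ step d ⟩
    (192 * (6 + d) + 320) + 192             ≤⟨ +-mono-≤ (192ℓ+320≤59*2^ℓ d)
                                                 (≤-trans (m≤m+n 192 3584) (*-monoʳ-≤ 59 (^-monoʳ-≤ 2 (m≤m+n 6 d)))) ⟩
    59 * 2 ^ (6 + d) + 59 * 2 ^ (6 + d)     ≡⟨ double (2 ^ (6 + d)) ⟩
    59 * 2 ^ (6 + suc d)                    ∎
    where
    open ≤-Reasoning
    step : ∀ d → 192 * (6 + suc d) + 320 ≡ (192 * (6 + d) + 320) + 192
    step = solve-∀
    double : ∀ x → 59 * x + 59 * x ≡ 59 * (2 * x)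
    double = solve-∀

  module _ {n} (n≥N : threshold ≤ n) where

    private
      k ℓ λ′ h y : ℕ
      k  = ⌊log₂ n ⌋
      ℓ  = ⌊log₂ k ⌋
      λ′ = ⌊log₂ ℓ ⌋
      h  = ℓ ∸ 6
      y  = sieveLimit n

      2^12≤k : 2 ^ 12 ≤ k
      2^12≤k = 2^j≤n⇒j≤⌊log₂n⌋ n≥N
      12≤ℓ : 12 ≤ ℓ
      12≤ℓ = 2^j≤n⇒j≤⌊log₂n⌋ 2^12≤k
      ℓ≡h+6 : ℓ ≡ h + 6
      ℓ≡h+6 = sym (m∸n+n≡m (≤-trans (m≤m+n 6 6) 12≤ℓ))
      6≤h : 6 ≤ h
      6≤h = ∸-monoˡ-≤ 6 12≤ℓ
      ℓ≤h+h : ℓ ≤ h + h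
      ℓ≤h+h = subst (_≤ h + h) (sym ℓ≡h+6) (+-monoʳ-≤ h 6≤h)

      2^k≤n : 2 ^ k ≤ n
      2^k≤n = 2^⌊log₂n⌋≤n (≤-trans (m^n>0 2 (2 ^ 12)) n≥N)
      2^ℓ≤k : 2 ^ ℓ ≤ k
      2^ℓ≤k = 2^⌊log₂n⌋≤n (≤-trans (m^n>0 2 12) 2^12≤k)
      2^λ′≤ℓ : 2 ^ λ′ ≤ ℓ
      2^λ′≤ℓ = 2^⌊log₂n⌋≤n (≤-trans (s≤s z≤n) 12≤ℓ)
      k<2^[1+ℓ] : k < 2 ^ suc ℓ
      k<2^[1+ℓ] = n<2^[1+⌊log₂n⌋] k
      ℓ<2^[1+λ′] : ℓ < 2 ^ suc λ′
      ℓ<2^[1+λ′] = n<2^[1+⌊log₂n⌋] ℓ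

      2^[a+b] : ∀ a b → 2 ^ a * 2 ^ b ≡ 2 ^ (a + b)
      2^[a+b] a b = sym (^-distribˡ-+-* 2 a b)

    L≤256*sieveLimit : L n ≤ 256 * sieveLimit n
    L≤256*sieveLimit = begin
      k * ℓ                          ≤⟨ *-mono-≤ (<⇒≤ k<2^[1+ℓ]) (<⇒≤ ℓ<2^[1+λ′]) ⟩
      2 ^ suc ℓ * 2 ^ suc λ′         ≡⟨ 2^[a+b] (suc ℓ) (suc λ′) ⟩
      2 ^ (suc ℓ + suc λ′)           ≡⟨ cong (λ l → 2 ^ (suc l + suc λ′)) ℓ≡h+6 ⟩
      2 ^ (suc (h + 6) + suc λ′)     ≡⟨ cong (2 ^_) (regroup h λ′) ⟩
      2 ^ (8 + (h + λ′))             ≡⟨ sym (2^[a+b] 8 (h + λ′)) ⟩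
      256 * y                        ∎
      where
      open ≤-Reasoning
      regroup : ∀ h λ′ → suc (h + 6) + suc λ′ ≡ 8 + (h + λ′)
      regroup = solve-∀

    private
      64πy≤5k+64 : 64 * π y ≤ 5 * k + 64
      64πy≤5k+64 = *-cancelˡ-≤ h {{>-nonZero (≤-trans (s≤s z≤n) 6≤h)}} (begin
        h * (64 * π y)
          ≡⟨ swap h (π y) ⟩
        64 * (h * π y)
          ≤⟨ *-monoʳ-≤ 64 (chebyshev h (h + λ′) (m≤m+n h λ′)) ⟩
        64 * (h * suc (2 ^ h) + 2 ^ suc (h + λ′))
          ≡⟨ expand h (2 ^ h) (2 ^ suc (h + λ′)) ⟩
        h * 64 + h * (2 ^ h * 2 ^ 6) + 2 ^ 6 * 2 ^ suc (h + λ′)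
          ≡⟨ cong₂ (λ u v → h * 64 + h * u + v) (2^[a+b] h 6)
                   (trans (2^[a+b] 6 (suc (h + λ′))) (cong (2 ^_) (shift h λ′))) ⟩
        h * 64 + h * 2 ^ (h + 6) + 2 ^ ((h + 6) + suc λ′)
          ≡⟨ cong (λ l → h * 64 + h * 2 ^ l + 2 ^ (l + suc λ′)) (sym ℓ≡h+6) ⟩
        h * 64 + h * 2 ^ ℓ + 2 ^ (ℓ + suc λ′)
          ≡⟨ cong (h * 64 + h * 2 ^ ℓ +_) (sym (2^[a+b] ℓ (suc λ′))) ⟩
        h * 64 + h * 2 ^ ℓ + 2 ^ ℓ * (2 * 2 ^ λ′)
          ≤⟨ +-mono-≤ (+-monoʳ-≤ (h * 64) (*-monoʳ-≤ h 2^ℓ≤k))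
                      (*-mono-≤ 2^ℓ≤k (*-monoʳ-≤ 2 (≤-trans 2^λ′≤ℓ ℓ≤h+h))) ⟩
        h * 64 + h * k + k * (2 * (h + h))
          ≡⟨ collect h k ⟩
        h * (5 * k + 64)
          ∎)
        where
        open ≤-Reasoning
        swap : ∀ h p → h * (64 * p) ≡ 64 * (h * p)
        swap = solve-∀
        expand : ∀ h x z → 64 * (h * suc x + z) ≡ h * 64 + h * (x * 64) + 64 * z
        expand = solve-∀
        shift : ∀ h λ′ → 6 + suc (h + λ′) ≡ (h + 6) + suc λ′
        shift = solve-∀
        collect : ∀ h k → h * 64 + h * k + k * (2 * (h + h)) ≡ h * (5 * k + 64)
        collect = solve-∀

      3ℓ+4+πy≤k : 3 * ℓ + 4 + π y ≤ k
      3ℓ+4+πy≤k = *-cancelˡ-≤ 64 (begin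
        64 * (3 * ℓ + 4 + π y)                 ≡⟨ expand ℓ (π y) ⟩
        (192 * ℓ + 256) + 64 * π y             ≤⟨ +-monoʳ-≤ (192 * ℓ + 256) 64πy≤5k+64 ⟩
        (192 * ℓ + 256) + (5 * k + 64)         ≡⟨ regroup ℓ k ⟩
        (192 * ℓ + 320) + 5 * k                ≤⟨ +-monoˡ-≤ (5 * k) 192ℓ+320≤59k ⟩
        59 * k + 5 * k                         ≡⟨ collect k ⟩
        64 * k                                 ∎)
        where
        open ≤-Reasoning
        expand : ∀ l p → 64 * (3 * l + 4 + p) ≡ (192 * l + 256) + 64 * p
        expand = solve-∀
        regroup : ∀ l k → (192 * l + 256) + (5 * k + 64) ≡ (192 * l + 320) + 5 * k
        regroup = solve-∀
        collect : ∀ k → 59 * k + 5 * k ≡ 64 * k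
        collect = solve-∀
        192ℓ+320≤59k : 192 * ℓ + 320 ≤ 59 * k
        192ℓ+320≤59k = ≤-trans (subst (λ l → 192 * l + 320 ≤ 59 * 2 ^ l) (trans (+-comm 6 h) (sym ℓ≡h+6))
                                       (192ℓ+320≤59*2^ℓ h))
                                (*-monoʳ-≤ 59 2^ℓ≤k)

    errorTerm*L≤n : errorTerm (sieveLimit n) * L n ≤ n
    errorTerm*L≤n = begin
      π y * 2 ^ suc (π y) * (k * ℓ)
        ≤⟨ *-mono-≤ (*-monoˡ-≤ (2 ^ suc (π y)) πy≤2^[1+ℓ]) (*-mono-≤ (<⇒≤ k<2^[1+ℓ]) ℓ≤2^[1+ℓ]) ⟩
      2 ^ suc ℓ * 2 ^ suc (π y) * (2 ^ suc ℓ * 2 ^ suc ℓ)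
        ≡⟨ cong₂ _*_ (2^[a+b] (suc ℓ) (suc (π y))) (2^[a+b] (suc ℓ) (suc ℓ)) ⟩
      2 ^ (suc ℓ + suc (π y)) * 2 ^ (suc ℓ + suc ℓ)
        ≡⟨ 2^[a+b] (suc ℓ + suc (π y)) (suc ℓ + suc ℓ) ⟩
      2 ^ (suc ℓ + suc (π y) + (suc ℓ + suc ℓ))
        ≡⟨ cong (2 ^_) (collect ℓ (π y)) ⟩
      2 ^ (3 * ℓ + 4 + π y)
        ≤⟨ ^-monoʳ-≤ 2 3ℓ+4+πy≤k ⟩
      2 ^ k
        ≤⟨ 2^k≤n ⟩
      n
        ∎
      where
      open ≤-Reasoning
      πy≤2^[1+ℓ] : π y ≤ 2 ^ suc ℓ
      πy≤2^[1+ℓ] = ≤-trans (≤-trans (m≤n+m (π y) (3 * ℓ + 4)) 3ℓ+4+πy≤k) (<⇒≤ k<2^[1+ℓ])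
      ℓ≤2^[1+ℓ] : ℓ ≤ 2 ^ suc ℓ
      ℓ≤2^[1+ℓ] = ≤-trans (<⇒≤ (n<2^n ℓ)) (≤-trans 2^ℓ≤k (<⇒≤ k<2^[1+ℓ]))
      collect : ∀ l p → suc l + suc p + (suc l + suc l) ≡ 3 * l + 4 + p
      collect = solve-∀

    [1+n]/[2+y]*L≤512n : suc n / (2 + sieveLimit n) * L n ≤ 512 * n
    [1+n]/[2+y]*L≤512n = begin
      B * (k * ℓ)                  ≤⟨ *-monoʳ-≤ B (≤-trans L≤256*sieveLimit (*-monoʳ-≤ 256 (m≤n+m y 2))) ⟩
      B * (256 * (2 + y))          ≡⟨ swap B (2 + y) ⟩
      256 * (B * (2 + y))          ≤⟨ *-monoʳ-≤ 256 (m/n*n≤m (suc n) (2 + y)) ⟩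
      256 * suc n                  ≤⟨ *-monoʳ-≤ 256 (+-monoˡ-≤ n (≤-trans (m^n>0 2 (2 ^ 12)) n≥N)) ⟩
      256 * (n + n)                ≡⟨ double n ⟩
      512 * n                      ∎
      where
      open ≤-Reasoning
      B : ℕ
      B = suc n / (2 + y)
      swap : ∀ b z → b * (256 * z) ≡ 256 * (b * z)
      swap = solve-∀
      double : ∀ n → 256 * (n + n) ≡ 512 * n
      double = solve-∀

module Asymptotics where

  open Rationals
  open Estimates using (errorTerm; cPartial*n-s≤; s-cPartial*n≤)
  open Parameters
  open import Data.Nat.Base as ℕ using (suc)
  import Data.Nat.Properties as ℕ
  open import Data.Nat.DivMod using (_/_)
  import Data.Nat.Tactic.RingSolver as ℕ-RingSolver
  open import Data.Rational.Base using (ℚ; _+_; _*_; _-_; _≤_)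
  open import Data.Rational.Properties using (+-monoʳ-≤; module ≤-Reasoning)
  open import Data.Rational.Solver using (module +-*-Solver)
  open +-*-Solver using (solve; _:+_; _:*_; _:=_)
  open import Relation.Binary.PropositionalEquality

  [cPartial*n-s]*L≤1024n : ∀ {n} → threshold ℕ.≤ n → ∀ M →
                  (cPartial M * toℚ n - toℚ (s n)) * toℚ (L n) ≤ toℚ 1024 * toℚ n
  [cPartial*n-s]*L≤1024n {n} n≥N M = begin
    (cPartial M * N - toℚ (s n)) * Λ      ≤⟨ *-monoʳ-≤-0≤ (toℚ-nonNeg (L n)) (cPartial*n-s≤ n y M) ⟩
    (toℚ E + N * inv (suc y)) * Λ         ≡⟨ distrib (toℚ E) N (inv (suc y)) Λ ⟩
    toℚ E * Λ + N * (inv (suc y) * Λ)     ≤⟨ +-monoʳ-≤ (toℚ E * Λ) (*-monoˡ-≤-0≤ (toℚ-nonNeg n)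
                                               (m≤o*n⇒inv[n]*m≤o {L n} {suc y} {256} L≤256[1+y])) ⟩
    toℚ E * Λ + N * toℚ 256               ≡⟨ sym (cong₂ _+_ (toℚ-* E (L n)) (toℚ-* n 256)) ⟩
    toℚ (E ℕ.* L n) + toℚ (n ℕ.* 256)     ≡⟨ sym (toℚ-+ (E ℕ.* L n) (n ℕ.* 256)) ⟩
    toℚ (E ℕ.* L n ℕ.+ n ℕ.* 256)         ≤⟨ toℚ-mono-≤ E*L+256n≤1024n ⟩
    toℚ (1024 ℕ.* n)                      ≡⟨ toℚ-* 1024 n ⟩
    toℚ 1024 * N                          ∎
    where
    open ≤-Reasoning
    y E : ℕ.ℕ
    y = sieveLimit n
    E = errorTerm y
    N Λ : ℚ
    N = toℚ n
    Λ = toℚ (L n)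
    L≤256[1+y] : L n ℕ.≤ 256 ℕ.* suc y
    L≤256[1+y] = ℕ.≤-trans (L≤256*sieveLimit n≥N) (ℕ.*-monoʳ-≤ 256 (ℕ.n≤1+n y))
    distrib : ∀ e N i Λ → (e + N * i) * Λ ≡ e * Λ + N * (i * Λ)
    distrib = solve 4 (λ e N i Λ → (e :+ N :* i) :* Λ := e :* Λ :+ N :* (i :* Λ)) refl
    n+256n≡257n : ∀ n → n ℕ.+ n ℕ.* 256 ≡ 257 ℕ.* n
    n+256n≡257n = ℕ-RingSolver.solve-∀
    E*L+256n≤1024n : E ℕ.* L n ℕ.+ n ℕ.* 256 ℕ.≤ 1024 ℕ.* n
    E*L+256n≤1024n = ℕ.≤-trans (ℕ.+-monoˡ-≤ (n ℕ.* 256) (errorTerm*L≤n n≥N))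
      (ℕ.≤-trans (ℕ.≤-reflexive (n+256n≡257n n)) (ℕ.*-monoˡ-≤ n (ℕ.m≤m+n 257 767)))

  [s-cPartial*n]*L≤1024n : ∀ {n} → threshold ℕ.≤ n →
                  (toℚ (s n) - cPartial (sieveLimit n) * toℚ n) * toℚ (L n) ≤ toℚ 1024 * toℚ n
  [s-cPartial*n]*L≤1024n {n} n≥N = begin
    (toℚ (s n) - cPartial y * toℚ n) * Λ  ≤⟨ *-monoʳ-≤-0≤ (toℚ-nonNeg (L n)) (s-cPartial*n≤ n y) ⟩
    (toℚ E + toℚ B) * Λ                   ≡⟨ cong (_* Λ) (sym (toℚ-+ E B)) ⟩
    toℚ (E ℕ.+ B) * Λ                     ≡⟨ sym (toℚ-* (E ℕ.+ B) (L n)) ⟩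
    toℚ ((E ℕ.+ B) ℕ.* L n)               ≤⟨ toℚ-mono-≤ [E+B]*L≤1024n ⟩
    toℚ (1024 ℕ.* n)                      ≡⟨ toℚ-* 1024 n ⟩
    toℚ 1024 * toℚ n                      ∎
    where
    open ≤-Reasoning
    y E B : ℕ.ℕ
    y = sieveLimit n
    E = errorTerm y
    B = suc n / (2 ℕ.+ y)
    Λ : ℚ
    Λ = toℚ (L n)
    n+512n≡513n : ∀ n → n ℕ.+ 512 ℕ.* n ≡ 513 ℕ.* n
    n+512n≡513n = ℕ-RingSolver.solve-∀
    [E+B]*L≤1024n : (E ℕ.+ B) ℕ.* L n ℕ.≤ 1024 ℕ.* n
    [E+B]*L≤1024n = ℕ.≤-trans (ℕ.≤-reflexive (ℕ.*-distribʳ-+ (L n) E B))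
      (ℕ.≤-trans (ℕ.+-mono-≤ (errorTerm*L≤n n≥N) ([1+n]/[2+y]*L≤512n n≥N))
        (ℕ.≤-trans (ℕ.≤-reflexive (n+512n≡513n n)) (ℕ.*-monoˡ-≤ n (ℕ.m≤m+n 513 511))))

open Rationals using (p≤p+q)
open Parameters using (sieveLimit; threshold)
open Asymptotics using ([cPartial*n-s]*L≤1024n; [s-cPartial*n]*L≤1024n)
open import Data.Nat using (ℕ; _≥_)
open import Data.Product using (Σ; _×_; ∃-syntax; _,_)
open import Data.Rational using (ℚ; _≤_; _<_; _-_; _*_; _+_; 0ℚ)
open import Data.Rational.Properties using (≤-trans; <⇒≤)

theorem2p1 : ∃[ C ] ∃[ N ] ∀ (n : ℕ) → n ≥ N →
    ((∀ (M : ℕ) → ((cPartial M * toℚ n) - toℚ (s n)) * toℚ (L n) ≤ toℚ C * toℚ n)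
    × (∀ (ε : ℚ) → 0ℚ < ε → ∃[ M ] ((toℚ (s n) - (cPartial M * toℚ n)) * toℚ (L n) ≤ (toℚ C * toℚ n) + ε)))
theorem2p1 = 1024 , threshold , λ n n≥N →
  [cPartial*n-s]*L≤1024n n≥N ,
  λ ε 0<ε → sieveLimit n , ≤-trans ([s-cPartial*n]*L≤1024n n≥N) (p≤p+q (<⇒≤ 0<ε))
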